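{- Let $S$ be a pure $n$-dimensional finite relative simplicial complex and $\tau$ an $h$-tiling of $S$. Then $$\sum_{k=0}^{n+1} h_k(\tau)X^k(X+1)^{n+1-k}=X\sum_{k=0}^{n} f_k(S)X^k+\sum_{k=0}^{n-1}c_k(\tau)X^k.$$ In particular, two $h$-tilings of $S$ have the same $h$-vector if and only if they have the same $c$-vector.
   Context: A finite relative simplicial complex $S=K\setminus L$ consists of a finite simplicial complex $K$ and a subcomplex $L$ containing no maximal simplex of $K$; $|S|=|K|\setminus|L|$; it is pure $n$-dimensional if all maximal simplices of $K$ have dimension $n$. $f_k(S)$ is the number of $k$-dimensional simplices of $K$ not belonging to $L$. A relative simplex is a simplex deprived of some proper faces. A basic tile of dimension $n$ and order $k\in\{0,\dots,n+1\}$ is an $n$-simplex deprived of $k$ of its $(n-1)$-faces; it has a unique face of least dimension $k-1$. A critical tile of dimension $n$ and index $k\in\{0,\dots,n\}$ is a basic tile of order $k$ deprived moreover of that $(k-1)$-dimensional face; its order is defined to be $k$ if $k<n$ and $n+1$ if $k=n$ (it is then the open simplex). An $h$-tiling of $S$ is a partition of $|S|$ into basic or critical tiles whose underlying simplices are simplices of $K$, such that for every $d\ge0$ the union of tiles of dimension $>d$ is closed in $|S|$. Its $h$-vector is $h(\tau)=(h_0(\tau),\dots,h_{n+1}(\tau))$ with $h_j(\tau)$ the number of tiles of order $j$ (counting critical tiles as well), and its $c$-vector is $c(\tau)=(c_0(\tau),\dots,c_n(\tau))$ with $c_j(\tau)$ the number of critical tiles of index $j$. -}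

module Defs where

open import Data.Nat using (ℕ; zero; suc; _+_; _*_; _∸_; _^_; _≤_; _<ᵇ_; _≡ᵇ_)
open import Data.Bool using (Bool; true; false; not; _∧_; _∨_; if_then_else_)
open import Data.Vec using (Vec; []; _∷_; tabulate)
open import Data.List using (List; []; _∷_; _++_; map; filterᵇ; head; upTo; length)
open import Data.Bool.ListAction using (all; any)
open import Data.Maybe using (Maybe; just; nothing)
open import Data.Fin using (toℕ)
open import Data.Fin.Subset using (Subset; _⊆_; ∣_∣)
open import Data.Product using (_×_)
import Data.List.Membership.Propositional
open import Relation.Binary.PropositionalEquality using (_≡_)

-- Vertices are Fin V; a (nonempty) simplex is a subset of Fin V.

_⊆ᵇ_ : ∀ {n} → Subset n → Subset n → Bool
[] ⊆ᵇ [] = true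
(x ∷ xs) ⊆ᵇ (y ∷ ys) = (not x ∨ y) ∧ (xs ⊆ᵇ ys)

_==ᵇ_ : ∀ {n} → Subset n → Subset n → Bool
a ==ᵇ b = (a ⊆ᵇ b) ∧ (b ⊆ᵇ a)

nonemptyᵇ : ∀ {n} → Subset n → Bool
nonemptyᵇ a = 0 <ᵇ ∣ a ∣

_⇔ᵇ_ : Bool → Bool → Bool
true ⇔ᵇ b = b
false ⇔ᵇ b = not b

allSubsets : ∀ n → List (Subset n)
allSubsets zero = [] ∷ []
allSubsets (suc n) = map (false ∷_) s ++ map (true ∷_) s
  where s = allSubsets n

count : ∀ {A : Set} → (A → Bool) → List A → ℕ
count p xs = length (filterᵇ p xs)

sumTo : ℕ → (ℕ → ℕ) → ℕ
sumTo zero g = 0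
sumTo (suc m) g = sumTo m g + g m

-- Finite relative simplicial complexes S = K ∖ L on vertex set Fin V.
-- K and L are given by their (nonempty) simplices.

IsMaximal : ∀ {V} → (Subset V → Bool) → Subset V → Set
IsMaximal {V} K σ = (K σ ≡ true) × (∀ (τ : Subset V) → K τ ≡ true → σ ⊆ τ → τ ≡ σ)

record RelComplex (V : ℕ) : Set where
  field
    K : Subset V → Bool
    L : Subset V → Bool
    K-nonempty : ∀ σ → K σ ≡ true → 1 ≤ ∣ σ ∣
    K-down : ∀ σ τ → K σ ≡ true → τ ⊆ σ → 1 ≤ ∣ τ ∣ → K τ ≡ true
    L-sub : ∀ σ → L σ ≡ true → K σ ≡ true
    L-down : ∀ σ τ → L σ ≡ true → τ ⊆ σ → 1 ≤ ∣ τ ∣ → L τ ≡ true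
    L-noMax : ∀ σ → IsMaximal K σ → L σ ≡ false

open RelComplex public

InS : ∀ {V} → RelComplex V → Subset V → Bool
InS S F = K S F ∧ not (L S F)

Pure : ∀ {V} → ℕ → RelComplex V → Set
Pure {V} n S = ∀ (σ : Subset V) → IsMaximal (K S) σ → ∣ σ ∣ ≡ suc n

fS : ∀ {V} → RelComplex V → ℕ → ℕ
fS {V} S k = count (λ F → InS S F ∧ (∣ F ∣ ≡ᵇ suc k)) (allSubsets V)

-- A basic tile (kind basic) is σ deprived of the |A| facets
-- not containing A: its open faces are the faces F of σ with A ⊆ F.
-- A critical tile (kind critical, |A| ≤ dim σ) is moreover deprived of A.
-- A point of |S| is identified with the open face containing it, so a
-- tile (as a subset of |S|) is the set of open faces it contains.

data Kind : Set where
  basic critical : Kind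

record Tile (V : ℕ) : Set where
  constructor tile
  field
    simplex : Subset V
    face    : Subset V
    kind    : Kind

open Tile public

dimT : ∀ {V} → Tile V → ℕ
dimT t = ∣ simplex t ∣ ∸ 1

basicSet : ∀ {V} → Subset V → Subset V → Subset V → Bool
basicSet σ A F = nonemptyᵇ F ∧ (F ⊆ᵇ σ) ∧ (A ⊆ᵇ F)

critSet : ∀ {V} → Subset V → Subset V → Subset V → Bool
critSet σ A F = basicSet σ A F ∧ not (F ==ᵇ A)

pts : ∀ {V} → Tile V → Subset V → Bool
pts (tile σ A basic) = basicSet σ A
pts (tile σ A critical) = critSet σ A

WellFormedTile : ∀ {V} → RelComplex V → Tile V → Set
WellFormedTile S (tile σ A basic) = (K S σ ≡ true) × (A ⊆ σ)
WellFormedTile S (tile σ A critical) = (K S σ ≡ true) × (A ⊆ σ) × (∣ A ∣ ≤ ∣ σ ∣ ∸ 1)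

sameSet : ∀ {V} → (Subset V → Bool) → (Subset V → Bool) → Bool
sameSet {V} P Q = all (λ F → P F ⇔ᵇ Q F) (allSubsets V)

isCritIdx : ∀ {V} → Tile V → ℕ → Bool
isCritIdx {V} t j =
  any (λ A → (A ⊆ᵇ simplex t) ∧ (∣ A ∣ ≡ᵇ j) ∧ (j <ᵇ ∣ simplex t ∣)
             ∧ sameSet (pts t) (critSet (simplex t) A))
      (allSubsets V)

critIndex : ∀ {V} → Tile V → Maybe ℕ
critIndex t = head (filterᵇ (isCritIdx t) (upTo ∣ simplex t ∣))

critOrder : ℕ → ℕ → ℕ
critOrder d k = if k <ᵇ d then k else suc d

order : ∀ {V} → Tile V → ℕ
order t with critIndex t
... | just k  = critOrder (dimT t) k
... | nothing = ∣ face t ∣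

unionAbove : ∀ {V} → List (Tile V) → ℕ → Subset V → Bool
unionAbove τ d F = any (λ t → (d <ᵇ dimT t) ∧ pts t F) τ

record HTiling {V} (S : RelComplex V) (τ : List (Tile V)) : Set where
  field
    wellFormed : ∀ t → Data.List.Membership.Propositional._∈_ t τ → WellFormedTile S t
    partition : ∀ F → count (λ t → pts t F) τ ≡ (if InS S F then 1 else 0)
    -- for every d, the union of tiles of dimension > d is closed in |S|
    closed : ∀ d F G → unionAbove τ d F ≡ true → G ⊆ F → InS S G ≡ true
             → unionAbove τ d G ≡ true

hT : ∀ {V} → List (Tile V) → ℕ → ℕ
hT τ j = count (λ t → order t ≡ᵇ j) τ

cT : ∀ {V} → List (Tile V) → ℕ → ℕ
cT τ j = count (λ t → isCritIdx t j) τ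

hVec : ∀ {V} (n : ℕ) → List (Tile V) → Vec ℕ (suc (suc n))
hVec n τ = tabulate (λ i → hT τ (toℕ i))

cVec : ∀ {V} (n : ℕ) → List (Tile V) → Vec ℕ (suc n)
cVec n τ = tabulate (λ i → cT τ (toℕ i))

-- A basic tile of order k on an n-simplex σ is the set of faces F with A ⊆ F ⊆ σ for a face A with
-- |A| = k, so its face generating function Σ X^|F| is X^k (X+1)^(n+1-k); a critical tile of index k
-- lacks A itself and contributes X^k less. Purity together with closedness of the unions of tiles of
-- large dimension forces every tile to be n-dimensional, and the tiles partition the faces of S, so
-- summing over tiles gives Σ h_k X^k (X+1)^(n+1-k) = Σ_{F ∈ S} X^|F| + Σ_{k<n} c_k X^k, where the
-- first sum on the right is X Σ f_k X^k. The critical tiles of index n are exactly the tiles of order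
-- n+1, so c_n = h_{n+1}; the equivalence of the two vectors follows because a polynomial with natural
-- coefficients is determined, both in the basis X^k and in the basis X^k (X+1)^(m-k), by its values
-- at the positive integers.

module Submission where

open import Defs
open import Data.Nat using (ℕ; suc; _+_; _*_; _∸_; _^_)
open import Data.List using (List)
open import Data.Product using (_×_)
open import Function.Bundles using (_⇔_)
open import Relation.Binary.PropositionalEquality using (_≡_)

open import Data.Nat using (zero; _≤_; _<_; _<ᵇ_; _≡ᵇ_; z≤n; s≤s)
open import Data.Nat.Logarithm using (⌊log₂_⌋; ⌊log₂[2^n]⌋≡n)
open import Data.Nat.Divisibility using (_∣_; m∣m*n; ∣m+n∣m⇒∣n; ∣1⇒≡1)
open import Data.Nat.DivMod using (_%_; [m+kn]%n≡m%n; m<n⇒m%n≡m)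
open import Data.Nat.Properties
open import Data.Bool using (Bool; true; false; not; _∧_; _∨_; if_then_else_; T)
open import Data.Bool.Properties using (∧-zeroʳ; ∧-identityʳ; ∧-comm; not-involutive; T-≡)
open import Data.Bool.ListAction using (all)
open import Data.List using ([]; _∷_; _++_; map; filterᵇ; head; upTo; applyUpTo)
open import Data.Maybe using (just; nothing)
open import Data.Fin.Subset using (Subset; ∣_∣; _⊆_) renaming (⊥ to ∅)
open import Data.Fin.Subset.Properties using (drop-∷-⊆; ⊆-refl; ⊆-trans; ⊆-antisym; p⊆q⇒∣p∣≤∣q∣; ∣⊥∣≡0)
open import Data.Vec using ([]; _∷_; here; there; tabulate; lookup)
open import Data.Vec.Properties using (lookup∘tabulate; tabulate-cong)
open import Data.Fin using (toℕ; fromℕ<)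
open import Data.Fin.Properties using (toℕ-fromℕ<; toℕ<n)
open import Data.List.Relation.Unary.Any using () renaming (here to hereˡ; there to thereˡ)
open import Data.List.Membership.Propositional using (find; lose) renaming (_∈_ to _∈ˡ_)
open import Data.List.Relation.Unary.Any.Properties using (any⁺; any⁻)
open import Data.List.Membership.Propositional.Properties using (∈-++⁺ˡ; ∈-++⁺ʳ; ∈-map⁺)
open import Data.Product using (Σ; _,_; proj₁; proj₂)
open import Data.Sum using (_⊎_; inj₁; inj₂)
open import Data.Empty using (⊥-elim)
open import Function using (_∘_; case_of_)
open import Function.Bundles using (Equivalence; mk⇔)
open import Relation.Nullary using (yes; no)
open import Relation.Binary.PropositionalEquality using (refl; sym; trans; cong; cong₂; subst; subst₂; _≢_; module ≡-Reasoning)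
open import Algebra.Properties.CommutativeSemigroup +-commutativeSemigroup using (interchange)
open import Algebra.Properties.CommutativeSemigroup *-commutativeSemigroup using (x∙yz≈y∙xz)
open ≡-Reasoning

𝟙 : Bool → ℕ
𝟙 b = if b then 1 else 0

sumBy : ∀ {A : Set} → (A → ℕ) → List A → ℕ
sumBy f [] = 0
sumBy f (x ∷ xs) = f x + sumBy f xs

sumBy-cong : ∀ {A : Set} {f g : A → ℕ} xs → (∀ x → f x ≡ g x) → sumBy f xs ≡ sumBy g xs
sumBy-cong [] _ = refl
sumBy-cong (x ∷ xs) f≗g = cong₂ _+_ (f≗g x) (sumBy-cong xs f≗g)

sumBy-cong-∈ : ∀ {A : Set} {f g : A → ℕ} xs → (∀ {x} → x ∈ˡ xs → f x ≡ g x) → sumBy f xs ≡ sumBy g xs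
sumBy-cong-∈ [] _ = refl
sumBy-cong-∈ (x ∷ xs) f≗g = cong₂ _+_ (f≗g (hereˡ refl)) (sumBy-cong-∈ xs (f≗g ∘ thereˡ))

sumBy-zero : ∀ {A : Set} (xs : List A) → sumBy (λ _ → 0) xs ≡ 0
sumBy-zero [] = refl
sumBy-zero (x ∷ xs) = sumBy-zero xs

sumBy-+ : ∀ {A : Set} (f g : A → ℕ) xs → sumBy (λ x → f x + g x) xs ≡ sumBy f xs + sumBy g xs
sumBy-+ f g [] = refl
sumBy-+ f g (x ∷ xs) = trans (cong (f x + g x +_) (sumBy-+ f g xs)) (interchange (f x) (g x) _ _)

sumBy-*ˡ : ∀ {A : Set} c (f : A → ℕ) xs → sumBy (λ x → c * f x) xs ≡ c * sumBy f xs
sumBy-*ˡ c f [] = sym (*-zeroʳ c)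
sumBy-*ˡ c f (x ∷ xs) = trans (cong (c * f x +_) (sumBy-*ˡ c f xs)) (sym (*-distribˡ-+ c (f x) _))

sumBy-*ʳ : ∀ {A : Set} c (f : A → ℕ) xs → sumBy (λ x → f x * c) xs ≡ sumBy f xs * c
sumBy-*ʳ c f xs = begin
  sumBy (λ x → f x * c) xs ≡⟨ sumBy-cong xs (λ x → *-comm (f x) c) ⟩
  sumBy (λ x → c * f x) xs ≡⟨ sumBy-*ˡ c f xs ⟩
  c * sumBy f xs           ≡⟨ *-comm c _ ⟩
  sumBy f xs * c           ∎

sumBy-++ : ∀ {A : Set} (f : A → ℕ) xs ys → sumBy f (xs ++ ys) ≡ sumBy f xs + sumBy f ys
sumBy-++ f [] ys = refl
sumBy-++ f (x ∷ xs) ys = trans (cong (f x +_) (sumBy-++ f xs ys)) (sym (+-assoc (f x) _ _))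

sumBy-map : ∀ {A B : Set} (f : B → ℕ) (g : A → B) xs → sumBy f (map g xs) ≡ sumBy (f ∘ g) xs
sumBy-map f g [] = refl
sumBy-map f g (x ∷ xs) = cong (f (g x) +_) (sumBy-map f g xs)

sumBy-comm : ∀ {A B : Set} (f : A → B → ℕ) xs ys →
  sumBy (λ x → sumBy (f x) ys) xs ≡ sumBy (λ y → sumBy (λ x → f x y) xs) ys
sumBy-comm f [] ys = sym (sumBy-zero ys)
sumBy-comm f (x ∷ xs) ys = trans (cong (sumBy (f x) ys +_) (sumBy-comm f xs ys))
  (sym (sumBy-+ (f x) (λ y → sumBy (λ x → f x y) xs) ys))

count≡sumBy : ∀ {A : Set} (p : A → Bool) xs → count p xs ≡ sumBy (𝟙 ∘ p) xs
count≡sumBy p [] = refl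
count≡sumBy p (x ∷ xs) with p x
... | true = cong suc (count≡sumBy p xs)
... | false = count≡sumBy p xs

count-cong-∈ : ∀ {A : Set} {p q : A → Bool} xs → (∀ {x} → x ∈ˡ xs → p x ≡ q x) → count p xs ≡ count q xs
count-cong-∈ {p = p} {q} xs p≗q = trans (count≡sumBy p xs) (trans (sumBy-cong-∈ xs (cong 𝟙 ∘ p≗q)) (sym (count≡sumBy q xs)))

∈⇒count>0 : ∀ {A : Set} (p : A → Bool) {x} xs → x ∈ˡ xs → p x ≡ true → 1 ≤ count p xs
∈⇒count>0 p (y ∷ xs) (hereˡ refl) px rewrite px = s≤s z≤n
∈⇒count>0 p (y ∷ xs) (thereˡ x∈xs) px with p y
... | true = s≤s z≤n
... | false = ∈⇒count>0 p xs x∈xs px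

count>0⇒∈ : ∀ {A : Set} (p : A → Bool) xs → 1 ≤ count p xs → Σ A λ x → x ∈ˡ xs × p x ≡ true
count>0⇒∈ p (y ∷ xs) 1≤count with p y in py
... | true = y , hereˡ refl , py
... | false = let x , x∈xs , px = count>0⇒∈ p xs 1≤count in x , thereˡ x∈xs , px

count-⊆ : ∀ {A : Set} {p q : A → Bool} → (∀ x → q x ≡ true → p x ≡ true) → ∀ xs → count q xs ≤ count p xs
count-⊆ q⊆p [] = z≤n
count-⊆ {p = p} {q} q⊆p (x ∷ xs) with q x in qx | p x in px
... | true | true = s≤s (count-⊆ q⊆p xs)
... | true | false with () ← trans (sym px) (q⊆p x qx)
... | false | true = m≤n⇒m≤1+n (count-⊆ q⊆p xs)
... | false | false = count-⊆ q⊆p xs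

count-⊆-≡⇒≗ : ∀ {A : Set} {p q : A → Bool} → (∀ x → q x ≡ true → p x ≡ true) →
  ∀ xs → count q xs ≡ count p xs → ∀ {x} → x ∈ˡ xs → q x ≡ p x
count-⊆-≡⇒≗ {p = p} {q} q⊆p (y ∷ xs) eq x∈ with q y in qy | p y in py | x∈
... | true | true | hereˡ refl = trans qy (sym py)
... | true | true | thereˡ x∈xs = count-⊆-≡⇒≗ q⊆p xs (suc-injective eq) x∈xs
... | false | false | hereˡ refl = trans qy (sym py)
... | false | false | thereˡ x∈xs = count-⊆-≡⇒≗ q⊆p xs eq x∈xs
... | true | false | _ with () ← trans (sym py) (q⊆p y qy)
... | false | true | _ = ⊥-elim (<-irrefl eq (s≤s (count-⊆ q⊆p xs)))

count-split : ∀ {A : Set} (p q : A → Bool) xs → count p xs ≡ count (λ x → q x ∧ p x) xs + count (λ x → not (q x) ∧ p x) xs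
count-split p q [] = refl
count-split p q (x ∷ xs) with p x | q x
... | true | true = cong suc (count-split p q xs)
... | true | false = trans (cong suc (count-split p q xs)) (sym (+-suc _ _))
... | false | true = count-split p q xs
... | false | false = count-split p q xs

count-split-≥2 : ∀ {A : Set} (p q : A → Bool) xs {x y} → x ∈ˡ xs → y ∈ˡ xs →
  q x ≡ true → p x ≡ true → q y ≡ false → p y ≡ true → 2 ≤ count p xs
count-split-≥2 p q xs {x} {y} x∈ y∈ qx px qy py = subst (2 ≤_) (sym (count-split p q xs))
  (+-mono-≤ (∈⇒count>0 (λ z → q z ∧ p z) xs x∈ (trans (cong₂ _∧_ qx px) refl))
            (∈⇒count>0 (λ z → not (q z) ∧ p z) xs y∈ (trans (cong₂ (λ a b → not a ∧ b) qy py) refl)))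

count≤1-agree : ∀ {A : Set} (p q : A → Bool) xs → count p xs ≤ 1 → ∀ {x y} → x ∈ˡ xs → y ∈ˡ xs →
  p x ≡ true → p y ≡ true → q x ≡ q y
count≤1-agree p q xs count≤1 {x} {y} x∈ y∈ px py with q x in qx | q y in qy
... | true | true = refl
... | false | false = refl
... | true | false = ⊥-elim (1+n≰n (≤-trans (count-split-≥2 p q xs x∈ y∈ qx px qy py) count≤1))
... | false | true = ⊥-elim (1+n≰n (≤-trans (count-split-≥2 p q xs y∈ x∈ qy py qx px) count≤1))

∃-max : ∀ {A : Set} (f : A → ℕ) (P : A → Bool) xs {x₀} → P x₀ ≡ true →
  Σ A λ m → P m ≡ true × (∀ y → y ∈ˡ xs → P y ≡ true → f y ≤ f m)
∃-max f P [] {x₀} px₀ = x₀ , px₀ , λ _ ()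
∃-max f P (y ∷ ys) px₀ with ∃-max f P ys px₀ | P y in py
... | m , pm , max | false = m , pm , λ
  { z (hereˡ refl) pz → ⊥-elim (case trans (sym py) pz of λ ())
  ; z (thereˡ z∈ys) pz → max z z∈ys pz }
... | m , pm , max | true with f y ≤? f m
...   | yes fy≤fm = m , pm , λ
  { z (hereˡ refl) _ → fy≤fm
  ; z (thereˡ z∈ys) pz → max z z∈ys pz }
...   | no fy≰fm = y , py , λ
  { z (hereˡ refl) _ → ≤-refl
  ; z (thereˡ z∈ys) pz → ≤-trans (max z z∈ys pz) (<⇒≤ (≰⇒> fy≰fm)) }

sumTo-cong : ∀ m {f g : ℕ → ℕ} → (∀ k → k < m → f k ≡ g k) → sumTo m f ≡ sumTo m g
sumTo-cong zero _ = refl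
sumTo-cong (suc m) f≗g = cong₂ _+_ (sumTo-cong m (λ k k<m → f≗g k (m<n⇒m<1+n k<m))) (f≗g m ≤-refl)

sumTo-zero : ∀ m → sumTo m (λ _ → 0) ≡ 0
sumTo-zero zero = refl
sumTo-zero (suc m) = trans (+-identityʳ _) (sumTo-zero m)

sumTo-*ˡ : ∀ m c (f : ℕ → ℕ) → sumTo m (λ k → c * f k) ≡ c * sumTo m f
sumTo-*ˡ zero c f = sym (*-zeroʳ c)
sumTo-*ˡ (suc m) c f = trans (cong (_+ c * f m) (sumTo-*ˡ m c f)) (sym (*-distribˡ-+ c (sumTo m f) _))

sumTo-suc : ∀ m (f : ℕ → ℕ) → sumTo (suc m) f ≡ f 0 + sumTo m (f ∘ suc)
sumTo-suc zero f = sym (+-identityʳ (f 0))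
sumTo-suc (suc m) f = trans (cong (_+ f (suc m)) (sumTo-suc m f)) (+-assoc (f 0) _ _)

sumTo-sumBy : ∀ {A : Set} m (f : ℕ → A → ℕ) xs →
  sumTo m (λ k → sumBy (f k) xs) ≡ sumBy (λ x → sumTo m (λ k → f k x)) xs
sumTo-sumBy zero f xs = sym (sumBy-zero xs)
sumTo-sumBy (suc m) f xs = trans (cong (_+ sumBy (f m) xs) (sumTo-sumBy m f xs))
  (sym (sumBy-+ (λ x → sumTo m (λ k → f k x)) (f m) xs))

sumTo-count : ∀ {A : Set} m (p : ℕ → A → Bool) (u : ℕ → ℕ) xs →
  sumTo m (λ k → count (p k) xs * u k) ≡ sumBy (λ x → sumTo m (λ k → 𝟙 (p k x) * u k)) xs
sumTo-count m p u xs = trans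
  (sumTo-cong m (λ k _ → trans (cong (_* u k) (count≡sumBy (p k) xs)) (sym (sumBy-*ʳ (u k) (𝟙 ∘ p k) xs))))
  (sumTo-sumBy m (λ k x → 𝟙 (p k x) * u k) xs)

≡ᵇ-refl : ∀ j → (j ≡ᵇ j) ≡ true
≡ᵇ-refl zero = refl
≡ᵇ-refl (suc j) = ≡ᵇ-refl j

≡ᵇ≡true⇒≡ : ∀ j k → (j ≡ᵇ k) ≡ true → j ≡ k
≡ᵇ≡true⇒≡ j k e = ≡ᵇ⇒≡ j k (subst T (sym e) _)

≢⇒≡ᵇ-false : ∀ {j k} → j ≢ k → (j ≡ᵇ k) ≡ false
≢⇒≡ᵇ-false {j} {k} j≢k with j ≡ᵇ k in e
... | true = ⊥-elim (j≢k (≡ᵇ≡true⇒≡ j k e))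
... | false = refl

<ᵇ-irrefl : ∀ n → (n <ᵇ n) ≡ false
<ᵇ-irrefl zero = refl
<ᵇ-irrefl (suc n) = <ᵇ-irrefl n

sumTo-𝟙-≡ᵇ-out : ∀ m j (u : ℕ → ℕ) → m ≤ j → sumTo m (λ k → 𝟙 (j ≡ᵇ k) * u k) ≡ 0
sumTo-𝟙-≡ᵇ-out zero j u _ = refl
sumTo-𝟙-≡ᵇ-out (suc m) j u m<j
  rewrite sumTo-𝟙-≡ᵇ-out m j u (<⇒≤ m<j) | ≢⇒≡ᵇ-false (>⇒≢ m<j) = refl

sumTo-𝟙-≡ᵇ : ∀ m j (u : ℕ → ℕ) → j < m → sumTo m (λ k → 𝟙 (j ≡ᵇ k) * u k) ≡ u j
sumTo-𝟙-≡ᵇ (suc m) j u j<1+m with j ≟ m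
... | yes refl rewrite sumTo-𝟙-≡ᵇ-out j j u ≤-refl | ≡ᵇ-refl j = +-identityʳ (u j)
... | no j≢m rewrite sumTo-𝟙-≡ᵇ m j u (≤∧≢⇒< (≤-pred j<1+m) j≢m) | ≢⇒≡ᵇ-false j≢m = +-identityʳ (u j)

2^-injective : ∀ {m n} → 2 ^ m ≡ 2 ^ n → m ≡ n
2^-injective {m} {n} e = trans (sym (⌊log₂[2^n]⌋≡n m)) (trans (cong ⌊log₂_⌋ e) (⌊log₂[2^n]⌋≡n n))

2^-suc+1≢2^-suc : ∀ a b → 2 ^ suc a + 1 ≢ 2 ^ suc b
2^-suc+1≢2^-suc a b e with () ← ∣1⇒≡1 (∣m+n∣m⇒∣n (subst (2 ∣_) (sym e) (m∣m*n (2 ^ b))) (m∣m*n (2 ^ a)))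

^-suc+^≡^*[1+] : ∀ X n → X ^ suc n + X ^ n ≡ X ^ n * (X + 1) ^ 1
^-suc+^≡^*[1+] X n = begin
  X * X ^ n + X ^ n         ≡⟨ cong₂ _+_ (*-comm X (X ^ n)) (sym (*-identityʳ (X ^ n))) ⟩
  X ^ n * X + X ^ n * 1     ≡⟨ sym (*-distribˡ-+ (X ^ n) X 1) ⟩
  X ^ n * (X + 1)           ≡⟨ cong (X ^ n *_) (sym (*-identityʳ (X + 1))) ⟩
  X ^ n * (X + 1) ^ 1       ∎

∧≡true⁻ : ∀ {b c} → (b ∧ c) ≡ true → (b ≡ true) × (c ≡ true)
∧≡true⁻ {true} {true} _ = refl , refl

⊆⇒⊆ᵇ : ∀ {n} {A B : Subset n} → A ⊆ B → (A ⊆ᵇ B) ≡ true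
⊆⇒⊆ᵇ {A = []} {[]} _ = refl
⊆⇒⊆ᵇ {A = false ∷ A} {b ∷ B} A⊆B = ⊆⇒⊆ᵇ (drop-∷-⊆ A⊆B)
⊆⇒⊆ᵇ {A = true ∷ A} {true ∷ B} A⊆B = ⊆⇒⊆ᵇ (drop-∷-⊆ A⊆B)
⊆⇒⊆ᵇ {A = true ∷ A} {false ∷ B} A⊆B with A⊆B here
... | ()

⊆ᵇ⇒⊆ : ∀ {n} (A B : Subset n) → (A ⊆ᵇ B) ≡ true → A ⊆ B
⊆ᵇ⇒⊆ (true ∷ A) (true ∷ B) _ here = here
⊆ᵇ⇒⊆ (a ∷ A) (b ∷ B) e (there x∈A) = there (⊆ᵇ⇒⊆ A B (proj₂ (∧≡true⁻ {not a ∨ b} e)) x∈A)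

⊆ᵇ-refl : ∀ {n} (A : Subset n) → (A ⊆ᵇ A) ≡ true
⊆ᵇ-refl A = ⊆⇒⊆ᵇ {A = A} ⊆-refl

==ᵇ⇒≡ : ∀ {n} (A B : Subset n) → (A ==ᵇ B) ≡ true → A ≡ B
==ᵇ⇒≡ A B e = let A⊆B , B⊆A = ∧≡true⁻ e in ⊆-antisym (⊆ᵇ⇒⊆ A B A⊆B) (⊆ᵇ⇒⊆ B A B⊆A)

==ᵇ-false : ∀ {n} (A B : Subset n) → ∣ B ∣ < ∣ A ∣ → (A ==ᵇ B) ≡ false
==ᵇ-false A B B<A with A ==ᵇ B in A≡B
... | false = refl
... | true with refl ← ==ᵇ⇒≡ A B A≡B = ⊥-elim (<-irrefl refl B<A)

⊆ᵇ⇒∣∣≤ : ∀ {n} (A B : Subset n) → (A ⊆ᵇ B) ≡ true → ∣ A ∣ ≤ ∣ B ∣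
⊆ᵇ⇒∣∣≤ A B = p⊆q⇒∣p∣≤∣q∣ ∘ ⊆ᵇ⇒⊆ A B

⊆ᵇ∧∣∣≥⇒≡ : ∀ {n} (A B : Subset n) → (A ⊆ᵇ B) ≡ true → ∣ B ∣ ≤ ∣ A ∣ → A ≡ B
⊆ᵇ∧∣∣≥⇒≡ [] [] _ _ = refl
⊆ᵇ∧∣∣≥⇒≡ (true ∷ A) (true ∷ B) A⊆B (s≤s ∣B∣≤∣A∣) = cong (true ∷_) (⊆ᵇ∧∣∣≥⇒≡ A B A⊆B ∣B∣≤∣A∣)
⊆ᵇ∧∣∣≥⇒≡ (false ∷ A) (false ∷ B) A⊆B ∣B∣≤∣A∣ = cong (false ∷_) (⊆ᵇ∧∣∣≥⇒≡ A B A⊆B ∣B∣≤∣A∣)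
⊆ᵇ∧∣∣≥⇒≡ (false ∷ A) (true ∷ B) A⊆B ∣B∣≤∣A∣ = ⊥-elim (<-irrefl refl (≤-trans (s≤s (⊆ᵇ⇒∣∣≤ A B A⊆B)) ∣B∣≤∣A∣))

∅⊆ᵇ : ∀ {n} (A : Subset n) → (∅ ⊆ᵇ A) ≡ true
∅⊆ᵇ [] = refl
∅⊆ᵇ (a ∷ A) = ∅⊆ᵇ A

⊆ᵇ∅≡not-nonemptyᵇ : ∀ {n} (F : Subset n) → (F ⊆ᵇ ∅) ≡ not (nonemptyᵇ F)
⊆ᵇ∅≡not-nonemptyᵇ [] = refl
⊆ᵇ∅≡not-nonemptyᵇ (false ∷ F) = ⊆ᵇ∅≡not-nonemptyᵇ F
⊆ᵇ∅≡not-nonemptyᵇ (true ∷ F) = refl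

==ᵇ∅≡not-nonemptyᵇ : ∀ {n} (F : Subset n) → (F ==ᵇ ∅) ≡ not (nonemptyᵇ F)
==ᵇ∅≡not-nonemptyᵇ F = begin
  (F ⊆ᵇ ∅) ∧ (∅ ⊆ᵇ F) ≡⟨ cong ((F ⊆ᵇ ∅) ∧_) (∅⊆ᵇ F) ⟩
  (F ⊆ᵇ ∅) ∧ true     ≡⟨ ∧-identityʳ _ ⟩
  F ⊆ᵇ ∅              ≡⟨ ⊆ᵇ∅≡not-nonemptyᵇ F ⟩
  not (nonemptyᵇ F)   ∎

∣∣≡0⇒≡∅ : ∀ {n} (A : Subset n) → ∣ A ∣ ≡ 0 → A ≡ ∅
∣∣≡0⇒≡∅ [] _ = refl
∣∣≡0⇒≡∅ (false ∷ A) e = cong (false ∷_) (∣∣≡0⇒≡∅ A e)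

∃-facet : ∀ {n} (σ : Subset n) k → ∣ σ ∣ ≡ suc k → Σ (Subset n) λ A → (A ⊆ᵇ σ) ≡ true × ∣ A ∣ ≡ k
∃-facet (true ∷ σ) k e = false ∷ σ , ⊆ᵇ-refl σ , suc-injective e
∃-facet (false ∷ σ) k e = let A , A⊆σ , ∣A∣ = ∃-facet σ k e in false ∷ A , A⊆σ , ∣A∣

∈-allSubsets : ∀ {n} (A : Subset n) → A ∈ˡ allSubsets n
∈-allSubsets [] = hereˡ refl
∈-allSubsets {suc n} (false ∷ A) = ∈-++⁺ˡ (∈-map⁺ (false ∷_) (∈-allSubsets A))
∈-allSubsets {suc n} (true ∷ A) = ∈-++⁺ʳ (map (false ∷_) (allSubsets n)) (∈-map⁺ (true ∷_) (∈-allSubsets A))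

sumBy-allSubsets-suc : ∀ {V} (f : Subset (suc V) → ℕ) →
  sumBy f (allSubsets (suc V)) ≡ sumBy (f ∘ (false ∷_)) (allSubsets V) + sumBy (f ∘ (true ∷_)) (allSubsets V)
sumBy-allSubsets-suc {V} f = trans (sumBy-++ f (map (false ∷_) (allSubsets V)) (map (true ∷_) (allSubsets V)))
  (cong₂ _+_ (sumBy-map f (false ∷_) (allSubsets V)) (sumBy-map f (true ∷_) (allSubsets V)))

sumBy-𝟙-==ᵇ : ∀ {V} (E : Subset V) (g : Subset V → ℕ) → sumBy (λ F → 𝟙 (F ==ᵇ E) * g F) (allSubsets V) ≡ g E
sumBy-𝟙-==ᵇ [] g = trans (+-identityʳ _) (*-identityˡ (g []))
sumBy-𝟙-==ᵇ {suc V} (false ∷ E) g = begin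
  sumBy (λ F → 𝟙 (F ==ᵇ (false ∷ E)) * g F) (allSubsets (suc V))
    ≡⟨ sumBy-allSubsets-suc (λ F → 𝟙 (F ==ᵇ (false ∷ E)) * g F) ⟩
  sumBy (λ F → 𝟙 (F ==ᵇ E) * g (false ∷ F)) (allSubsets V) + sumBy (λ _ → 0) (allSubsets V)
    ≡⟨ cong₂ _+_ (sumBy-𝟙-==ᵇ E (g ∘ (false ∷_))) (sumBy-zero (allSubsets V)) ⟩
  g (false ∷ E) + 0                                                  ≡⟨ +-identityʳ _ ⟩
  g (false ∷ E)                                                      ∎
sumBy-𝟙-==ᵇ {suc V} (true ∷ E) g = begin
  sumBy (λ F → 𝟙 (F ==ᵇ (true ∷ E)) * g F) (allSubsets (suc V))
    ≡⟨ sumBy-allSubsets-suc (λ F → 𝟙 (F ==ᵇ (true ∷ E)) * g F) ⟩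
  sumBy (λ F → 𝟙 ((F ⊆ᵇ E) ∧ false) * g (false ∷ F)) (allSubsets V) + sumBy (λ F → 𝟙 (F ==ᵇ E) * g (true ∷ F)) (allSubsets V)
    ≡⟨ cong₂ _+_ (trans (sumBy-cong (allSubsets V) (λ F → cong (λ b → 𝟙 b * g (false ∷ F)) (∧-zeroʳ (F ⊆ᵇ E))))
                        (sumBy-zero (allSubsets V)))
                 (sumBy-𝟙-==ᵇ E (g ∘ (true ∷_))) ⟩
  g (true ∷ E)                                                      ∎

⇔ᵇ-≡ : ∀ b c → (b ⇔ᵇ c) ≡ true → b ≡ c
⇔ᵇ-≡ true true _ = refl
⇔ᵇ-≡ false false _ = refl

⇔ᵇ-refl : ∀ b → (b ⇔ᵇ b) ≡ true
⇔ᵇ-refl true = refl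
⇔ᵇ-refl false = refl

sameSet⇒≗ : ∀ {V} {P Q : Subset V → Bool} → sameSet P Q ≡ true → ∀ F → P F ≡ Q F
sameSet⇒≗ {V} {P} {Q} same F = go (allSubsets V) same (∈-allSubsets F)
  where
    go : ∀ xs → all (λ F → P F ⇔ᵇ Q F) xs ≡ true → F ∈ˡ xs → P F ≡ Q F
    go (x ∷ xs) all⇔ (hereˡ refl) = ⇔ᵇ-≡ (P x) (Q x) (proj₁ (∧≡true⁻ all⇔))
    go (x ∷ xs) all⇔ (thereˡ F∈xs) = go xs (proj₂ (∧≡true⁻ {P x ⇔ᵇ Q x} all⇔)) F∈xs

≗⇒sameSet : ∀ {V} {P Q : Subset V → Bool} → (∀ F → P F ≡ Q F) → sameSet P Q ≡ true
≗⇒sameSet {V} {P} {Q} P≗Q = go (allSubsets V)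
  where
    go : ∀ xs → all (λ F → P F ⇔ᵇ Q F) xs ≡ true
    go [] = refl
    go (x ∷ xs) rewrite P≗Q x | ⇔ᵇ-refl (Q x) = go xs

faceGF : ∀ {V} → (Subset V → Bool) → ℕ → ℕ
faceGF {V} P X = sumBy (λ F → 𝟙 (P F) * X ^ ∣ F ∣) (allSubsets V)

faceGF-cong : ∀ {V} {P Q : Subset V → Bool} → (∀ F → P F ≡ Q F) → ∀ X → faceGF P X ≡ faceGF Q X
faceGF-cong {V} P≗Q X = sumBy-cong (allSubsets V) (λ F → cong (λ b → 𝟙 b * X ^ ∣ F ∣) (P≗Q F))

faceGF-suc : ∀ {V} (P : Subset (suc V) → Bool) X →
  faceGF P X ≡ faceGF (P ∘ (false ∷_)) X + X * faceGF (P ∘ (true ∷_)) X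
faceGF-suc {V} P X = trans (sumBy-allSubsets-suc (λ F → 𝟙 (P F) * X ^ ∣ F ∣)) (cong (faceGF (P ∘ (false ∷_)) X +_)
  (trans (sumBy-cong (allSubsets V) (λ F → x∙yz≈y∙xz (𝟙 (P (true ∷ F))) X _)) (sumBy-*ˡ X _ (allSubsets V))))

faceGF-1 : ∀ {V} (P : Subset V → Bool) → faceGF P 1 ≡ count P (allSubsets V)
faceGF-1 {V} P = trans (sumBy-cong (allSubsets V) (λ F → trans (cong (𝟙 (P F) *_) (^-zeroˡ ∣ F ∣)) (*-identityʳ _)))
  (sym (count≡sumBy P (allSubsets V)))

interval : ∀ {V} → Subset V → Subset V → Subset V → Bool
interval σ A F = (F ⊆ᵇ σ) ∧ (A ⊆ᵇ F)

faceGF-interval : ∀ {V} (σ A : Subset V) X → (A ⊆ᵇ σ) ≡ true →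
  faceGF (interval σ A) X ≡ X ^ ∣ A ∣ * (X + 1) ^ (∣ σ ∣ ∸ ∣ A ∣)
faceGF-interval [] [] X _ = refl
faceGF-interval {suc V} (false ∷ σ) (false ∷ A) X A⊆σ = begin
  faceGF (interval (false ∷ σ) (false ∷ A)) X     ≡⟨ faceGF-suc (interval (false ∷ σ) (false ∷ A)) X ⟩
  faceGF (interval σ A) X + X * faceGF {V} (λ _ → false) X
    ≡⟨ cong₂ (λ a b → a + X * b) (faceGF-interval σ A X A⊆σ) (sumBy-zero (allSubsets V)) ⟩
  X ^ ∣ A ∣ * (X + 1) ^ (∣ σ ∣ ∸ ∣ A ∣) + X * 0    ≡⟨ cong (X ^ ∣ A ∣ * (X + 1) ^ (∣ σ ∣ ∸ ∣ A ∣) +_) (*-zeroʳ X) ⟩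
  X ^ ∣ A ∣ * (X + 1) ^ (∣ σ ∣ ∸ ∣ A ∣) + 0        ≡⟨ +-identityʳ _ ⟩
  X ^ ∣ A ∣ * (X + 1) ^ (∣ σ ∣ ∸ ∣ A ∣)            ∎
faceGF-interval (true ∷ σ) (false ∷ A) X A⊆σ = begin
  faceGF (interval (true ∷ σ) (false ∷ A)) X      ≡⟨ faceGF-suc (interval (true ∷ σ) (false ∷ A)) X ⟩
  I + X * I                                        ≡⟨ cong (_+ X * I) (sym (*-identityˡ I)) ⟩
  1 * I + X * I                                    ≡⟨ sym (*-distribʳ-+ I 1 X) ⟩
  (1 + X) * I                                      ≡⟨ cong₂ _*_ (+-comm 1 X) (faceGF-interval σ A X A⊆σ) ⟩
  (X + 1) * (X ^ ∣ A ∣ * (X + 1) ^ (∣ σ ∣ ∸ ∣ A ∣)) ≡⟨ x∙yz≈y∙xz (X + 1) (X ^ ∣ A ∣) _ ⟩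
  X ^ ∣ A ∣ * (X + 1) ^ suc (∣ σ ∣ ∸ ∣ A ∣)
    ≡⟨ cong (λ e → X ^ ∣ A ∣ * (X + 1) ^ e) (sym (+-∸-assoc 1 (⊆ᵇ⇒∣∣≤ A σ A⊆σ))) ⟩
  X ^ ∣ A ∣ * (X + 1) ^ (suc ∣ σ ∣ ∸ ∣ A ∣)        ∎
  where I = faceGF (interval σ A) X
faceGF-interval {suc V} (true ∷ σ) (true ∷ A) X A⊆σ = begin
  faceGF (interval (true ∷ σ) (true ∷ A)) X       ≡⟨ faceGF-suc (interval (true ∷ σ) (true ∷ A)) X ⟩
  faceGF (λ F → (F ⊆ᵇ σ) ∧ false) X + X * faceGF (interval σ A) X
    ≡⟨ cong₂ (λ a b → a + X * b) (trans (faceGF-cong (λ F → ∧-zeroʳ (F ⊆ᵇ σ)) X) (sumBy-zero (allSubsets V)))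
                                  (faceGF-interval σ A X A⊆σ) ⟩
  X * (X ^ ∣ A ∣ * (X + 1) ^ (∣ σ ∣ ∸ ∣ A ∣))      ≡⟨ sym (*-assoc X _ _) ⟩
  X ^ suc ∣ A ∣ * (X + 1) ^ (∣ σ ∣ ∸ ∣ A ∣)        ∎

𝟙-∧-not-split : ∀ b c w → 𝟙 b * w ≡ 𝟙 (b ∧ not c) * w + 𝟙 c * (𝟙 b * w)
𝟙-∧-not-split false c w = sym (*-zeroʳ (𝟙 c))
𝟙-∧-not-split true false w = sym (+-identityʳ _)
𝟙-∧-not-split true true w = sym (*-identityˡ _)

faceGF-remove : ∀ {V} (P : Subset V → Bool) (E : Subset V) X →
  faceGF P X ≡ faceGF (λ F → P F ∧ not (F ==ᵇ E)) X + 𝟙 (P E) * X ^ ∣ E ∣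
faceGF-remove {V} P E X = begin
  faceGF P X
    ≡⟨ sumBy-cong (allSubsets V) (λ F → 𝟙-∧-not-split (P F) (F ==ᵇ E) (X ^ ∣ F ∣)) ⟩
  sumBy (λ F → 𝟙 (P F ∧ not (F ==ᵇ E)) * X ^ ∣ F ∣ + 𝟙 (F ==ᵇ E) * (𝟙 (P F) * X ^ ∣ F ∣)) (allSubsets V)
    ≡⟨ sumBy-+ _ _ (allSubsets V) ⟩
  faceGF (λ F → P F ∧ not (F ==ᵇ E)) X + sumBy (λ F → 𝟙 (F ==ᵇ E) * (𝟙 (P F) * X ^ ∣ F ∣)) (allSubsets V)
    ≡⟨ cong (faceGF (λ F → P F ∧ not (F ==ᵇ E)) X +_) (sumBy-𝟙-==ᵇ E (λ F → 𝟙 (P F) * X ^ ∣ F ∣)) ⟩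
  faceGF (λ F → P F ∧ not (F ==ᵇ E)) X + 𝟙 (P E) * X ^ ∣ E ∣ ∎

-- basicSet omits the empty face, which the interval [A, σ] contains exactly when A = ∅.
faceGF-basic : ∀ {V} (σ A : Subset V) X → (A ⊆ᵇ σ) ≡ true →
  faceGF (basicSet σ A) X + 𝟙 (not (nonemptyᵇ A)) ≡ X ^ ∣ A ∣ * (X + 1) ^ (∣ σ ∣ ∸ ∣ A ∣)
faceGF-basic {V} σ A X A⊆σ = begin
  faceGF (basicSet σ A) X + 𝟙 (not (nonemptyᵇ A))
    ≡⟨ cong₂ _+_ (faceGF-cong basic≗ X) (sym empty-term) ⟩
  faceGF (λ F → interval σ A F ∧ not (F ==ᵇ ∅)) X + 𝟙 (interval σ A ∅) * X ^ ∣ ∅ {V} ∣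
    ≡⟨ sym (faceGF-remove (interval σ A) ∅ X) ⟩
  faceGF (interval σ A) X ≡⟨ faceGF-interval σ A X A⊆σ ⟩
  X ^ ∣ A ∣ * (X + 1) ^ (∣ σ ∣ ∸ ∣ A ∣) ∎
  where
    basic≗ : ∀ F → basicSet σ A F ≡ interval σ A F ∧ not (F ==ᵇ ∅)
    basic≗ F = begin
      nonemptyᵇ F ∧ interval σ A F             ≡⟨ ∧-comm (nonemptyᵇ F) _ ⟩
      interval σ A F ∧ nonemptyᵇ F             ≡⟨ cong (interval σ A F ∧_) (sym (not-involutive _)) ⟩
      interval σ A F ∧ not (not (nonemptyᵇ F)) ≡⟨ cong (λ b → interval σ A F ∧ not b) (sym (==ᵇ∅≡not-nonemptyᵇ F)) ⟩
      interval σ A F ∧ not (F ==ᵇ ∅)           ∎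
    empty-term : 𝟙 (interval σ A ∅) * X ^ ∣ ∅ {V} ∣ ≡ 𝟙 (not (nonemptyᵇ A))
    empty-term rewrite ∅⊆ᵇ σ | ⊆ᵇ∅≡not-nonemptyᵇ A | ∣⊥∣≡0 V = *-identityʳ _

^∣∣≡nonempty+empty : ∀ {n} (A : Subset n) X → 𝟙 (nonemptyᵇ A) * X ^ ∣ A ∣ + 𝟙 (not (nonemptyᵇ A)) ≡ X ^ ∣ A ∣
^∣∣≡nonempty+empty A X with ∣ A ∣
... | zero = refl
... | suc k = trans (+-identityʳ _) (*-identityˡ _)

faceGF-critical : ∀ {V} (σ A : Subset V) X → (A ⊆ᵇ σ) ≡ true →
  faceGF (critSet σ A) X + X ^ ∣ A ∣ ≡ X ^ ∣ A ∣ * (X + 1) ^ (∣ σ ∣ ∸ ∣ A ∣)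
faceGF-critical σ A X A⊆σ = begin
  faceGF (critSet σ A) X + X ^ ∣ A ∣
    ≡⟨ cong (faceGF (critSet σ A) X +_) (sym (^∣∣≡nonempty+empty A X)) ⟩
  faceGF (critSet σ A) X + (𝟙 (nonemptyᵇ A) * X ^ ∣ A ∣ + 𝟙 (not (nonemptyᵇ A)))
    ≡⟨ sym (+-assoc (faceGF (critSet σ A) X) _ _) ⟩
  faceGF (critSet σ A) X + 𝟙 (nonemptyᵇ A) * X ^ ∣ A ∣ + 𝟙 (not (nonemptyᵇ A))
    ≡⟨ cong (λ b → faceGF (critSet σ A) X + 𝟙 b * X ^ ∣ A ∣ + 𝟙 (not (nonemptyᵇ A))) (sym A∈basic) ⟩
  faceGF (critSet σ A) X + 𝟙 (basicSet σ A A) * X ^ ∣ A ∣ + 𝟙 (not (nonemptyᵇ A))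
    ≡⟨ cong (_+ 𝟙 (not (nonemptyᵇ A))) (sym (faceGF-remove (basicSet σ A) A X)) ⟩
  faceGF (basicSet σ A) X + 𝟙 (not (nonemptyᵇ A)) ≡⟨ faceGF-basic σ A X A⊆σ ⟩
  X ^ ∣ A ∣ * (X + 1) ^ (∣ σ ∣ ∸ ∣ A ∣) ∎
  where
    A∈basic : basicSet σ A A ≡ nonemptyᵇ A
    A∈basic rewrite A⊆σ | ⊆ᵇ-refl A = ∧-identityʳ _

faceGF-basic-1 : ∀ {V} (σ A : Subset V) → (A ⊆ᵇ σ) ≡ true →
  faceGF (basicSet σ A) 1 + 𝟙 (not (nonemptyᵇ A)) ≡ 2 ^ (∣ σ ∣ ∸ ∣ A ∣)
faceGF-basic-1 σ A A⊆σ = trans (faceGF-basic σ A 1 A⊆σ) (trans (cong (_* 2 ^ (∣ σ ∣ ∸ ∣ A ∣)) (^-zeroˡ ∣ A ∣)) (*-identityˡ _))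

faceGF-critical-1 : ∀ {V} (σ A : Subset V) → (A ⊆ᵇ σ) ≡ true → faceGF (critSet σ A) 1 + 1 ≡ 2 ^ (∣ σ ∣ ∸ ∣ A ∣)
faceGF-critical-1 σ A A⊆σ = begin
  faceGF (critSet σ A) 1 + 1         ≡⟨ cong (faceGF (critSet σ A) 1 +_) (sym (^-zeroˡ ∣ A ∣)) ⟩
  faceGF (critSet σ A) 1 + 1 ^ ∣ A ∣ ≡⟨ faceGF-critical σ A 1 A⊆σ ⟩
  1 ^ ∣ A ∣ * 2 ^ (∣ σ ∣ ∸ ∣ A ∣)     ≡⟨ cong (_* 2 ^ (∣ σ ∣ ∸ ∣ A ∣)) (^-zeroˡ ∣ A ∣) ⟩
  1 * 2 ^ (∣ σ ∣ ∸ ∣ A ∣)             ≡⟨ *-identityˡ _ ⟩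
  2 ^ (∣ σ ∣ ∸ ∣ A ∣)                 ∎

faceGF-open : ∀ {V} (σ : Subset V) X → 1 ≤ ∣ σ ∣ → faceGF (basicSet σ σ) X ≡ X ^ ∣ σ ∣
faceGF-open σ X 1≤σ with faceGF-basic σ σ X (⊆ᵇ-refl σ)
... | basic-gf rewrite Equivalence.to T-≡ (<⇒<ᵇ 1≤σ) | n∸n≡0 ∣ σ ∣ =
  trans (sym (+-identityʳ _)) (trans basic-gf (*-identityʳ _))

-- Both sides consist of σ alone; the count of the right-hand side is 2^1 - 1.
open≗critical-on-facet : ∀ {V} (σ A : Subset V) → (A ⊆ᵇ σ) ≡ true → ∣ σ ∣ ≡ suc ∣ A ∣ →
  ∀ F → basicSet σ σ F ≡ critSet σ A F
open≗critical-on-facet {V} σ A A⊆σ ∣σ∣ F = count-⊆-≡⇒≗ open⊆critical (allSubsets V) counts (∈-allSubsets F)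
  where
    1≤σ : 1 ≤ ∣ σ ∣
    1≤σ = subst (1 ≤_) (sym ∣σ∣) (s≤s z≤n)
    σ∈critical : critSet σ A σ ≡ true
    σ∈critical rewrite ==ᵇ-false σ A (subst (∣ A ∣ <_) (sym ∣σ∣) ≤-refl)
                     | Equivalence.to T-≡ (<⇒<ᵇ 1≤σ) | ⊆ᵇ-refl σ | A⊆σ = refl
    open⊆critical : ∀ F → basicSet σ σ F ≡ true → critSet σ A F ≡ true
    open⊆critical F F∈open = subst (λ G → critSet σ A G ≡ true) (sym F≡σ) σ∈critical
      where
        F⊆σ∧σ⊆F = ∧≡true⁻ (proj₂ (∧≡true⁻ {nonemptyᵇ F} F∈open))
        F≡σ = ⊆-antisym (⊆ᵇ⇒⊆ F σ (proj₁ F⊆σ∧σ⊆F)) (⊆ᵇ⇒⊆ σ F (proj₂ F⊆σ∧σ⊆F))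
    criticalCount : faceGF (critSet σ A) 1 + 1 ≡ 2
    criticalCount = begin
      faceGF (critSet σ A) 1 + 1 ≡⟨ faceGF-critical-1 σ A A⊆σ ⟩
      2 ^ (∣ σ ∣ ∸ ∣ A ∣)         ≡⟨ cong (λ m → 2 ^ (m ∸ ∣ A ∣)) ∣σ∣ ⟩
      2 ^ (suc ∣ A ∣ ∸ ∣ A ∣)     ≡⟨ cong (2 ^_) (m+n∸n≡m 1 ∣ A ∣) ⟩
      2                           ∎
    counts : count (basicSet σ σ) (allSubsets V) ≡ count (critSet σ A) (allSubsets V)
    counts = begin
      count (basicSet σ σ) (allSubsets V) ≡⟨ sym (faceGF-1 (basicSet σ σ)) ⟩
      faceGF (basicSet σ σ) 1             ≡⟨ trans (faceGF-open σ 1 1≤σ) (^-zeroˡ ∣ σ ∣) ⟩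
      1                                   ≡⟨ +-cancelʳ-≡ 1 _ _ (sym criticalCount) ⟩
      faceGF (critSet σ A) 1              ≡⟨ faceGF-1 (critSet σ A) ⟩
      count (critSet σ A) (allSubsets V)  ∎

-- A critical tile of index j on σ has 2^(|σ| - j) - 1 faces, so the index is read off the face count.
isCritIdx⇒faceCount : ∀ {V} (t : Tile V) j → isCritIdx t j ≡ true →
  j < ∣ simplex t ∣ × faceGF (pts t) 1 + 1 ≡ 2 ^ (∣ simplex t ∣ ∸ j)
isCritIdx⇒faceCount {V} t j crit
  with A , _ , isCrit ← find (any⁻ _ (allSubsets V) (Equivalence.from T-≡ crit))
  with A⊆σ , rest ← ∧≡true⁻ (Equivalence.to T-≡ isCrit)
  with ∣A∣≡j , rest ← ∧≡true⁻ rest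
  with j<σ , same ← ∧≡true⁻ rest = <ᵇ⇒< j ∣ σ ∣ (Equivalence.from T-≡ j<σ) , (begin
    faceGF (pts t) 1 + 1                ≡⟨ cong (_+ 1) (faceGF-cong {P = pts t} {critSet σ A} (sameSet⇒≗ same) 1) ⟩
    faceGF (critSet σ A) 1 + 1          ≡⟨ faceGF-critical-1 σ A A⊆σ ⟩
    2 ^ (∣ σ ∣ ∸ ∣ A ∣)                  ≡⟨ cong (λ a → 2 ^ (∣ σ ∣ ∸ a)) (≡ᵇ≡true⇒≡ ∣ A ∣ j ∣A∣≡j) ⟩
    2 ^ (∣ σ ∣ ∸ j)                      ∎)
  where σ = simplex t

isCritIdx-false : ∀ {V} (t : Tile V) j →
  (j < ∣ simplex t ∣ → faceGF (pts t) 1 + 1 ≢ 2 ^ (∣ simplex t ∣ ∸ j)) → isCritIdx t j ≡ false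
isCritIdx-false t j noCount with isCritIdx t j in crit
... | true = let j<σ , count = isCritIdx⇒faceCount t j crit in ⊥-elim (noCount j<σ count)
... | false = refl

isCritIdx-intro : ∀ {V} (t : Tile V) (A : Subset V) → (A ⊆ᵇ simplex t) ≡ true → ∣ A ∣ < ∣ simplex t ∣ →
  sameSet (pts t) (critSet (simplex t) A) ≡ true → isCritIdx t ∣ A ∣ ≡ true
isCritIdx-intro t A A⊆σ A<σ same = Equivalence.to T-≡ (any⁺ _ (lose (∈-allSubsets A) (Equivalence.from T-≡ isCrit)))
  where
    isCrit : ((A ⊆ᵇ simplex t) ∧ (∣ A ∣ ≡ᵇ ∣ A ∣) ∧ (∣ A ∣ <ᵇ ∣ simplex t ∣) ∧ sameSet (pts t) (critSet (simplex t) A)) ≡ true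
    isCrit rewrite A⊆σ | ≡ᵇ-refl ∣ A ∣ | Equivalence.to T-≡ (<⇒<ᵇ A<σ) = same

isCritIdx-unique : ∀ {V} (t : Tile V) {i j} → isCritIdx t i ≡ true → isCritIdx t j ≡ true → i ≡ j
isCritIdx-unique t {i} {j} crit-i crit-j =
  ∸-cancelˡ-≡ (<⇒≤ i<σ) (<⇒≤ j<σ) (2^-injective (trans (sym count-i) count-j))
  where
    i<σ = proj₁ (isCritIdx⇒faceCount t i crit-i)
    count-i = proj₂ (isCritIdx⇒faceCount t i crit-i)
    j<σ = proj₁ (isCritIdx⇒faceCount t j crit-j)
    count-j = proj₂ (isCritIdx⇒faceCount t j crit-j)

head-filterᵇ-applyUpTo : ∀ (p : ℕ → Bool) (f : ℕ → ℕ) m i → i < m → p (f i) ≡ true →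
  (∀ j → j < i → p (f j) ≡ false) → head (filterᵇ p (applyUpTo f m)) ≡ just (f i)
head-filterᵇ-applyUpTo p f (suc m) zero _ hit _ rewrite hit = refl
head-filterᵇ-applyUpTo p f (suc m) (suc i) (s≤s i<m) hit miss rewrite miss 0 (s≤s z≤n) =
  head-filterᵇ-applyUpTo p (f ∘ suc) m i i<m hit (λ j j<i → miss (suc j) (s≤s j<i))

head-filterᵇ-applyUpTo-none : ∀ (p : ℕ → Bool) (f : ℕ → ℕ) m →
  (∀ j → j < m → p (f j) ≡ false) → head (filterᵇ p (applyUpTo f m)) ≡ nothing
head-filterᵇ-applyUpTo-none p f zero _ = refl
head-filterᵇ-applyUpTo-none p f (suc m) miss rewrite miss 0 (s≤s z≤n) =
  head-filterᵇ-applyUpTo-none p (f ∘ suc) m (λ j j<m → miss (suc j) (s≤s j<m))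

order-critical : ∀ {V} (t : Tile V) {k} → critIndex t ≡ just k → order t ≡ critOrder (dimT t) k
order-critical t e with critIndex t
order-critical t refl | just _ = refl

order-noncritical : ∀ {V} (t : Tile V) → critIndex t ≡ nothing → order t ≡ ∣ face t ∣
order-noncritical t e with critIndex t
order-noncritical t refl | nothing = refl

record TileProfile {V} (n : ℕ) (t : Tile V) : Set where
  field
    order≤ : order t ≤ suc n
    faceGF-order : ∀ X → X ^ order t * (X + 1) ^ (suc n ∸ order t)
                           ≡ faceGF (pts t) X + sumTo n (λ k → 𝟙 (isCritIdx t k) * X ^ k)
    isCritIdx-top : isCritIdx t n ≡ (order t ≡ᵇ suc n)

mkTileProfile : ∀ {V} n (t : Tile V) {o} → order t ≡ o → o ≤ suc n →
  (∀ X → X ^ o * (X + 1) ^ (suc n ∸ o) ≡ faceGF (pts t) X + sumTo n (λ k → 𝟙 (isCritIdx t k) * X ^ k)) →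
  isCritIdx t n ≡ (o ≡ᵇ suc n) → TileProfile n t
mkTileProfile n t refl o≤ gf top = record { order≤ = o≤ ; faceGF-order = gf ; isCritIdx-top = top }

profile-of-critIdx : ∀ {V} n (t : Tile V) c → ∣ simplex t ∣ ≡ suc n → isCritIdx t c ≡ true →
  (∀ X → faceGF (pts t) X + X ^ c ≡ X ^ c * (X + 1) ^ (suc n ∸ c)) → TileProfile n t
profile-of-critIdx n t c ∣σ∣ crit faceGF-t = profile (m≤n⇒m<n∨m≡n c≤n)
  where
    c≤n : c ≤ n
    c≤n = ≤-pred (subst (c <_) ∣σ∣ (proj₁ (isCritIdx⇒faceCount t c crit)))
    isCritIdx≡ : ∀ j → isCritIdx t j ≡ (c ≡ᵇ j)
    isCritIdx≡ j with isCritIdx t j in crit-j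
    ... | true = sym (subst (λ i → (c ≡ᵇ i) ≡ true) (isCritIdx-unique t crit crit-j) (≡ᵇ-refl c))
    ... | false = sym (≢⇒≡ᵇ-false {c} {j} λ { refl → case trans (sym crit) crit-j of λ () })
    order≡ : order t ≡ critOrder n c
    order≡ = trans (order-critical t (trans (cong (λ m → head (filterᵇ (isCritIdx t) (upTo m))) ∣σ∣)
      (head-filterᵇ-applyUpTo (isCritIdx t) (λ j → j) (suc n) c (s≤s c≤n) crit
        (λ j j<c → trans (isCritIdx≡ j) (≢⇒≡ᵇ-false (>⇒≢ j<c))))))
      (cong (λ d → critOrder d c) (cong (_∸ 1) ∣σ∣))
    critSum : ∀ X → sumTo n (λ k → 𝟙 (isCritIdx t k) * X ^ k) ≡ sumTo n (λ k → 𝟙 (c ≡ᵇ k) * X ^ k)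
    critSum X = sumTo-cong n (λ k _ → cong (λ b → 𝟙 b * X ^ k) (isCritIdx≡ k))
    profile : c < n ⊎ c ≡ n → TileProfile n t
    profile (inj₁ c<n) = mkTileProfile n t (trans order≡ (cong (if_then c else suc n) (Equivalence.to T-≡ (<⇒<ᵇ c<n))))
      (m≤n⇒m≤1+n c≤n)
      (λ X → begin
          X ^ c * (X + 1) ^ (suc n ∸ c)  ≡⟨ sym (faceGF-t X) ⟩
          faceGF (pts t) X + X ^ c       ≡⟨ cong (faceGF (pts t) X +_) (sym (trans (critSum X) (sumTo-𝟙-≡ᵇ n c (X ^_) c<n))) ⟩
          faceGF (pts t) X + sumTo n (λ k → 𝟙 (isCritIdx t k) * X ^ k) ∎)
      (trans (isCritIdx≡ n) (trans (≢⇒≡ᵇ-false (<⇒≢ c<n)) (sym (≢⇒≡ᵇ-false (<⇒≢ (m<n⇒m<1+n c<n))))))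
    profile (inj₂ refl) = mkTileProfile c t (trans order≡ (cong (if_then c else suc c) (<ᵇ-irrefl c)))
      ≤-refl
      (λ X → begin
          X ^ suc c * (X + 1) ^ (suc c ∸ suc c) ≡⟨ cong (λ e → X ^ suc c * (X + 1) ^ e) (n∸n≡0 c) ⟩
          X ^ suc c * 1                          ≡⟨ *-identityʳ _ ⟩
          X ^ suc c
            ≡⟨ +-cancelʳ-≡ (X ^ c) _ _ (trans (^-suc+^≡^*[1+] X c) (sym (trans (faceGF-t X)
                 (cong (λ e → X ^ c * (X + 1) ^ e) (m+n∸n≡m 1 c))))) ⟩
          faceGF (pts t) X                       ≡⟨ sym (+-identityʳ _) ⟩
          faceGF (pts t) X + 0                   ≡⟨ cong (faceGF (pts t) X +_) (sym (trans (critSum X) (sumTo-𝟙-≡ᵇ-out c c (X ^_) ≤-refl))) ⟩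
          faceGF (pts t) X + sumTo c (λ k → 𝟙 (isCritIdx t k) * X ^ k) ∎)
      (trans crit (sym (≡ᵇ-refl (suc c))))

profile-critical : ∀ {V} n (σ A : Subset V) → (A ⊆ᵇ σ) ≡ true → ∣ σ ∣ ≡ suc n → ∣ A ∣ ≤ n →
  TileProfile n (tile σ A critical)
profile-critical n σ A A⊆σ ∣σ∣ A≤n = profile-of-critIdx n (tile σ A critical) ∣ A ∣ ∣σ∣
  (isCritIdx-intro (tile σ A critical) A A⊆σ (subst (∣ A ∣ <_) (sym ∣σ∣) (s≤s A≤n)) (≗⇒sameSet {P = critSet σ A} (λ _ → refl)))
  (λ X → trans (faceGF-critical σ A X A⊆σ) (cong (λ m → X ^ ∣ A ∣ * (X + 1) ^ (m ∸ ∣ A ∣)) ∣σ∣))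

-- Removing the empty face removes nothing, so this basic tile is the critical tile of index 0.
profile-basic-∅ : ∀ {V} n (σ : Subset V) → ∣ σ ∣ ≡ suc n → TileProfile n (tile σ ∅ basic)
profile-basic-∅ {V} n σ ∣σ∣ = profile-of-critIdx n t 0 ∣σ∣ crit gf
  where
    t = tile σ ∅ basic
    basic≗critical : ∀ F → basicSet σ ∅ F ≡ critSet σ ∅ F
    basic≗critical F = trans (absorb (nonemptyᵇ F) (interval σ ∅ F))
      (cong (λ b → basicSet σ ∅ F ∧ not b) (sym (==ᵇ∅≡not-nonemptyᵇ F)))
      where
        absorb : ∀ b c → (b ∧ c) ≡ (b ∧ c) ∧ not (not b)
        absorb true c = sym (∧-identityʳ c)
        absorb false c = refl
    crit : isCritIdx t 0 ≡ true
    crit = subst (λ k → isCritIdx t k ≡ true) (∣⊥∣≡0 V)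
      (isCritIdx-intro t ∅ (∅⊆ᵇ σ) (subst₂ _<_ (sym (∣⊥∣≡0 V)) (sym ∣σ∣) (s≤s z≤n)) (≗⇒sameSet basic≗critical))
    gf : ∀ X → faceGF (basicSet σ ∅) X + 1 ≡ 1 * (X + 1) ^ (suc n)
    gf X with faceGF-critical σ ∅ X (∅⊆ᵇ σ)
    ... | critical-gf rewrite ∣⊥∣≡0 V | ∣σ∣ = trans (cong (_+ 1) (faceGF-cong basic≗critical X)) critical-gf

profile-basic-proper : ∀ {V} n (σ A : Subset V) → (A ⊆ᵇ σ) ≡ true → ∣ σ ∣ ≡ suc n → 1 ≤ ∣ A ∣ → ∣ A ∣ ≤ n →
  TileProfile n (tile σ A basic)
profile-basic-proper n σ A A⊆σ ∣σ∣ 1≤A A≤n = mkTileProfile n t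
  (order-noncritical t (trans (cong (λ m → head (filterᵇ (isCritIdx t) (upTo m))) ∣σ∣)
    (head-filterᵇ-applyUpTo-none (isCritIdx t) (λ j → j) (suc n) (λ j _ → noncritical j))))
  (m≤n⇒m≤1+n A≤n)
  (λ X → begin
    X ^ ∣ A ∣ * (X + 1) ^ (suc n ∸ ∣ A ∣) ≡⟨ sym (faceGF-basic′ X) ⟩
    faceGF (basicSet σ A) X + 0
      ≡⟨ cong (faceGF (basicSet σ A) X +_) (sym (trans (sumTo-cong n (λ k _ → cong (λ b → 𝟙 b * X ^ k) (noncritical k)))
                                                        (sumTo-zero n))) ⟩
    faceGF (basicSet σ A) X + sumTo n (λ k → 𝟙 (isCritIdx t k) * X ^ k) ∎)
  (trans (noncritical n) (sym (≢⇒≡ᵇ-false (<⇒≢ (s≤s A≤n)))))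
  where
    t = tile σ A basic
    faceGF-basic′ : ∀ X → faceGF (basicSet σ A) X + 0 ≡ X ^ ∣ A ∣ * (X + 1) ^ (suc n ∸ ∣ A ∣)
    faceGF-basic′ X with faceGF-basic σ A X A⊆σ
    ... | basic-gf rewrite Equivalence.to T-≡ (<⇒<ᵇ 1≤A) | ∣σ∣ = basic-gf
    faceCount : faceGF (basicSet σ A) 1 ≡ 2 ^ (suc n ∸ ∣ A ∣)
    faceCount with faceGF-basic-1 σ A A⊆σ
    ... | basic-count rewrite Equivalence.to T-≡ (<⇒<ᵇ 1≤A) | ∣σ∣ = trans (sym (+-identityʳ _)) basic-count
    noncritical : ∀ j → isCritIdx t j ≡ false
    noncritical j = isCritIdx-false t j λ j<σ count → 2^-suc+1≢2^-suc (n ∸ ∣ A ∣) (n ∸ j) (begin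
      2 ^ suc (n ∸ ∣ A ∣) + 1     ≡⟨ cong (λ e → 2 ^ e + 1) (sym (+-∸-assoc 1 A≤n)) ⟩
      2 ^ (suc n ∸ ∣ A ∣) + 1     ≡⟨ cong (_+ 1) (sym faceCount) ⟩
      faceGF (pts t) 1 + 1       ≡⟨ count ⟩
      2 ^ (∣ σ ∣ ∸ j)             ≡⟨ cong (λ m → 2 ^ (m ∸ j)) ∣σ∣ ⟩
      2 ^ (suc n ∸ j)             ≡⟨ cong (2 ^_) (+-∸-assoc 1 (≤-pred (subst (j <_) ∣σ∣ j<σ))) ⟩
      2 ^ suc (n ∸ j)             ∎)

profile-basic-full : ∀ {V} n (σ : Subset V) → ∣ σ ∣ ≡ suc n → TileProfile n (tile σ σ basic)
profile-basic-full {V} n σ ∣σ∣ = profile-of-critIdx n t n ∣σ∣ crit gf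
  where
    t = tile σ σ basic
    facet = ∃-facet σ n ∣σ∣
    A = proj₁ facet
    A⊆σ = proj₁ (proj₂ facet)
    ∣A∣ = proj₂ (proj₂ facet)
    crit : isCritIdx t n ≡ true
    crit = subst (λ k → isCritIdx t k ≡ true) ∣A∣ (isCritIdx-intro t A A⊆σ (subst₂ _<_ (sym ∣A∣) (sym ∣σ∣) ≤-refl)
      (≗⇒sameSet (open≗critical-on-facet σ A A⊆σ (trans ∣σ∣ (cong suc (sym ∣A∣))))))
    gf : ∀ X → faceGF (basicSet σ σ) X + X ^ n ≡ X ^ n * (X + 1) ^ (suc n ∸ n)
    gf X = begin
      faceGF (basicSet σ σ) X + X ^ n ≡⟨ cong (_+ X ^ n) (trans (faceGF-open σ X (subst (1 ≤_) (sym ∣σ∣) (s≤s z≤n)))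
                                                              (cong (X ^_) ∣σ∣)) ⟩
      X ^ suc n + X ^ n               ≡⟨ ^-suc+^≡^*[1+] X n ⟩
      X ^ n * (X + 1) ^ 1             ≡⟨ cong (λ e → X ^ n * (X + 1) ^ e) (sym (m+n∸n≡m 1 n)) ⟩
      X ^ n * (X + 1) ^ (suc n ∸ n)   ∎

tileProfile : ∀ {V} {S : RelComplex V} n (t : Tile V) → WellFormedTile S t → ∣ simplex t ∣ ≡ suc n → TileProfile n t
tileProfile n (tile σ A critical) (_ , A⊆σ , A≤σ-1) ∣σ∣ =
  profile-critical n σ A (⊆⇒⊆ᵇ A⊆σ) ∣σ∣ (subst (λ m → ∣ A ∣ ≤ m ∸ 1) ∣σ∣ A≤σ-1)
tileProfile n (tile σ A basic) (_ , A⊆σ) ∣σ∣ with ∣ A ∣ in ∣A∣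
... | zero with refl ← ∣∣≡0⇒≡∅ A ∣A∣ = profile-basic-∅ n σ ∣σ∣
... | suc a with suc a ≤? n
...   | yes A≤n = profile-basic-proper n σ A (⊆⇒⊆ᵇ A⊆σ) ∣σ∣ (subst (1 ≤_) (sym ∣A∣) (s≤s z≤n)) (subst (_≤ n) (sym ∣A∣) A≤n)
...   | no A≰n with refl ← ⊆ᵇ∧∣∣≥⇒≡ A σ (⊆⇒⊆ᵇ A⊆σ) (subst₂ _≤_ (sym ∣σ∣) (sym ∣A∣) (≰⇒> A≰n)) = profile-basic-full n σ ∣σ∣

pts⇒basicSet : ∀ {V} (t : Tile V) F → pts t F ≡ true → basicSet (simplex t) (face t) F ≡ true
pts⇒basicSet (tile σ A basic) F F∈t = F∈t
pts⇒basicSet (tile σ A critical) F F∈t = proj₁ (∧≡true⁻ {basicSet σ A F} F∈t)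

pts⇒⊆ᵇ : ∀ {V} (t : Tile V) F → pts t F ≡ true → (F ⊆ᵇ simplex t) ≡ true
pts⇒⊆ᵇ t F F∈t = proj₁ (∧≡true⁻ (proj₂ (∧≡true⁻ {nonemptyᵇ F} (pts⇒basicSet t F F∈t))))

wellFormed⇒K : ∀ {V} {S : RelComplex V} (t : Tile V) → WellFormedTile S t → K S (simplex t) ≡ true
wellFormed⇒K (tile σ A basic) (σ∈K , _) = σ∈K
wellFormed⇒K (tile σ A critical) (σ∈K , _) = σ∈K

simplex∈pts : ∀ {V} {S : RelComplex V} (t : Tile V) → WellFormedTile S t → pts t (simplex t) ≡ true
simplex∈pts {S = S} (tile σ A basic) (σ∈K , A⊆σ)
  rewrite Equivalence.to T-≡ (<⇒<ᵇ (K-nonempty S σ σ∈K)) | ⊆ᵇ-refl σ = ⊆⇒⊆ᵇ A⊆σ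
simplex∈pts {S = S} (tile σ A critical) (σ∈K , A⊆σ , A≤σ-1)
  rewrite ==ᵇ-false σ A (≤-<-trans A≤σ-1 (∸-monoʳ-< {o = 0} (s≤s z≤n) (K-nonempty S σ σ∈K)))
        | Equivalence.to T-≡ (<⇒<ᵇ (K-nonempty S σ σ∈K)) | ⊆ᵇ-refl σ | ⊆⇒⊆ᵇ A⊆σ = refl

maximal-above : ∀ {V} (S : RelComplex V) (σ : Subset V) → K S σ ≡ true →
  Σ (Subset V) λ M → IsMaximal (K S) M × (σ ⊆ᵇ M) ≡ true
maximal-above {V} S σ σ∈K
  with M , M∈K∧σ⊆M , max ← ∃-max ∣_∣ (λ F → K S F ∧ (σ ⊆ᵇ F)) (allSubsets V)
                              (trans (cong (_∧ (σ ⊆ᵇ σ)) σ∈K) (⊆ᵇ-refl σ))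
  with M∈K , σ⊆M ← ∧≡true⁻ M∈K∧σ⊆M = M , (M∈K , M-maximal) , σ⊆M
  where
    M-maximal : ∀ N → K S N ≡ true → M ⊆ N → N ≡ M
    M-maximal N N∈K M⊆N = sym (⊆ᵇ∧∣∣≥⇒≡ M N (⊆⇒⊆ᵇ M⊆N) (max N (∈-allSubsets N)
      (trans (cong (_∧ (σ ⊆ᵇ N)) N∈K) (⊆⇒⊆ᵇ (⊆-trans (⊆ᵇ⇒⊆ σ M σ⊆M) M⊆N)))))

pure⇒∣∣≤ : ∀ {V} {n} {S : RelComplex V} → Pure n S → ∀ F → K S F ≡ true → ∣ F ∣ ≤ suc n
pure⇒∣∣≤ {S = S} pure F F∈K =
  let M , M-max , F⊆M = maximal-above S F F∈K in subst (∣ F ∣ ≤_) (pure M M-max) (⊆ᵇ⇒∣∣≤ F M F⊆M)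

faceGF-InS : ∀ {V} {n} {S : RelComplex V} → Pure n S → ∀ X →
  X * sumTo (suc n) (λ k → fS S k * X ^ k) ≡ faceGF (InS S) X
faceGF-InS {V} {n} {S} pure X = begin
  X * sumTo (suc n) (λ k → fS S k * X ^ k)
    ≡⟨ cong (X *_) (sumTo-count (suc n) (λ k F → InS S F ∧ (∣ F ∣ ≡ᵇ suc k)) (X ^_) (allSubsets V)) ⟩
  X * sumBy (λ F → sumTo (suc n) (λ k → 𝟙 (InS S F ∧ (∣ F ∣ ≡ᵇ suc k)) * X ^ k)) (allSubsets V)
    ≡⟨ sym (sumBy-*ˡ X _ (allSubsets V)) ⟩
  sumBy (λ F → X * sumTo (suc n) (λ k → 𝟙 (InS S F ∧ (∣ F ∣ ≡ᵇ suc k)) * X ^ k)) (allSubsets V)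
    ≡⟨ sumBy-cong (allSubsets V) byDimension ⟩
  faceGF (InS S) X ∎
  where
    byDimension : ∀ F → X * sumTo (suc n) (λ k → 𝟙 (InS S F ∧ (∣ F ∣ ≡ᵇ suc k)) * X ^ k) ≡ 𝟙 (InS S F) * X ^ ∣ F ∣
    byDimension F with InS S F in F∈S
    ... | false = trans (cong (X *_) (sumTo-zero (suc n))) (*-zeroʳ X)
    ... | true with ∣ F ∣ | K-nonempty S F (proj₁ (∧≡true⁻ {K S F} {not (L S F)} F∈S)) | pure⇒∣∣≤ {S = S} pure F (proj₁ (∧≡true⁻ {K S F} {not (L S F)} F∈S))
    ...   | suc j | _ | j<1+n = trans (cong (X *_) (sumTo-𝟙-≡ᵇ (suc n) j (X ^_) j<1+n)) (sym (*-identityˡ _))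

module _ {V} {n : ℕ} {S : RelComplex V} (pure : Pure n S) {τ : List (Tile V)} (H : HTiling S τ) where
  open HTiling H

  tile-containing : ∀ F → InS S F ≡ true → Σ (Tile V) λ t → t ∈ˡ τ × pts t F ≡ true
  tile-containing F F∈S = count>0⇒∈ (λ t → pts t F) τ (subst (1 ≤_) (sym (trans (partition F) (cong 𝟙 F∈S))) ≤-refl)

  pts⇒InS : ∀ {t F} → t ∈ˡ τ → pts t F ≡ true → InS S F ≡ true
  pts⇒InS {t} {F} t∈τ F∈t with InS S F in F∈S
  ... | true = refl
  ... | false = ⊥-elim (1+n≰n (subst (1 ≤_) (trans (partition F) (cong 𝟙 F∈S)) (∈⇒count>0 (λ u → pts u F) τ t∈τ F∈t)))

  tiles-agree : ∀ (q : Tile V → Bool) {t u F} → t ∈ˡ τ → u ∈ˡ τ → pts t F ≡ true → pts u F ≡ true → q t ≡ q u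
  tiles-agree q {F = F} = count≤1-agree (λ t → pts t F) q τ (subst (_≤ 1) (sym (partition F)) (𝟙≤1 (InS S F)))
    where
      𝟙≤1 : ∀ b → 𝟙 b ≤ 1
      𝟙≤1 true = ≤-refl
      𝟙≤1 false = z≤n

  -- If dim u > dim t, closedness of the union of the tiles of dimension > dim t puts F in a second tile.
  dimT-antitone : ∀ {t u F G} → t ∈ˡ τ → u ∈ˡ τ → pts t F ≡ true → pts u G ≡ true → F ⊆ G → dimT u ≤ dimT t
  dimT-antitone {t} {u} {F} {G} t∈τ u∈τ F∈t G∈u F⊆G with dimT u ≤? dimT t
  ... | yes u≤t = u≤t
  ... | no u≰t = ⊥-elim (case trans (sym (<ᵇ-irrefl (dimT t))) (trans (tiles-agree (λ v → dimT t <ᵇ dimT v) t∈τ v∈τ F∈t F∈v) v-above)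
                          of λ ())
    where
      G-above : unionAbove τ (dimT t) G ≡ true
      G-above = Equivalence.to T-≡ (any⁺ _ (lose u∈τ (Equivalence.from T-≡
        (trans (cong (_∧ pts u G) (Equivalence.to T-≡ (<⇒<ᵇ (≰⇒> u≰t)))) G∈u))))
      F-above = closed (dimT t) G F G-above F⊆G (pts⇒InS t∈τ F∈t)
      witness = find (any⁻ _ τ (Equivalence.from T-≡ F-above))
      v = proj₁ witness
      v∈τ = proj₁ (proj₂ witness)
      v-above∧F∈v = ∧≡true⁻ (Equivalence.to T-≡ (proj₂ (proj₂ witness)))
      v-above = proj₁ v-above∧F∈v
      F∈v = proj₂ v-above∧F∈v

  faceGF-partition : ∀ X → sumBy (λ t → faceGF (pts t) X) τ ≡ faceGF (InS S) X
  faceGF-partition X = begin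
    sumBy (λ t → faceGF (pts t) X) τ
      ≡⟨ sumBy-comm (λ t F → 𝟙 (pts t F) * X ^ ∣ F ∣) τ (allSubsets V) ⟩
    sumBy (λ F → sumBy (λ t → 𝟙 (pts t F) * X ^ ∣ F ∣) τ) (allSubsets V)
      ≡⟨ sumBy-cong (allSubsets V) tilesOfFace ⟩
    faceGF (InS S) X ∎
    where
      tilesOfFace : ∀ F → sumBy (λ t → 𝟙 (pts t F) * X ^ ∣ F ∣) τ ≡ 𝟙 (InS S F) * X ^ ∣ F ∣
      tilesOfFace F = begin
        sumBy (λ t → 𝟙 (pts t F) * X ^ ∣ F ∣) τ ≡⟨ sumBy-*ʳ (X ^ ∣ F ∣) (λ t → 𝟙 (pts t F)) τ ⟩
        sumBy (λ t → 𝟙 (pts t F)) τ * X ^ ∣ F ∣ ≡⟨ cong (_* X ^ ∣ F ∣) (sym (count≡sumBy (λ t → pts t F) τ)) ⟩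
        count (λ t → pts t F) τ * X ^ ∣ F ∣     ≡⟨ cong (_* X ^ ∣ F ∣) (partition F) ⟩
        𝟙 (InS S F) * X ^ ∣ F ∣                 ∎

  tile-full-dimensional : ∀ {t} → t ∈ˡ τ → ∣ simplex t ∣ ≡ suc n
  tile-full-dimensional {t} t∈τ = ≤-antisym (subst (∣ σ ∣ ≤_) ∣M∣ (⊆ᵇ⇒∣∣≤ σ M σ⊆M))
    (subst (suc n ≤_) (m+[n∸m]≡n (K-nonempty S σ σ∈K)) (s≤s n≤dimσ))
    where
      σ = simplex t
      wf = wellFormed t t∈τ
      σ∈K = wellFormed⇒K t wf
      above = maximal-above S σ σ∈K
      M = proj₁ above
      M-max = proj₁ (proj₂ above)
      σ⊆M = proj₂ (proj₂ above)
      ∣M∣ = pure M M-max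
      M∈S : InS S M ≡ true
      M∈S rewrite proj₁ M-max | L-noMax S M M-max = refl
      containing = tile-containing M M∈S
      u = proj₁ containing
      u∈τ = proj₁ (proj₂ containing)
      M∈u = proj₂ (proj₂ containing)
      simplex-u : simplex u ≡ M
      simplex-u = proj₂ M-max (simplex u) (wellFormed⇒K u (wellFormed u u∈τ)) (⊆ᵇ⇒⊆ M (simplex u) (pts⇒⊆ᵇ u M M∈u))
      n≤dimσ : n ≤ ∣ σ ∣ ∸ 1
      n≤dimσ = subst (_≤ ∣ σ ∣ ∸ 1) (cong (_∸ 1) (trans (cong ∣_∣ simplex-u) ∣M∣))
        (dimT-antitone t∈τ u∈τ (simplex∈pts t wf) M∈u (⊆ᵇ⇒⊆ σ M σ⊆M))

  profileOf : ∀ {t} → t ∈ˡ τ → TileProfile n t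
  profileOf {t} t∈τ = tileProfile n t (wellFormed t t∈τ) (tile-full-dimensional t∈τ)

  h-polynomial-identity : ∀ X →
    sumTo (suc (suc n)) (λ k → hT τ k * (X ^ k) * ((X + 1) ^ (suc n ∸ k)))
      ≡ X * sumTo (suc n) (λ k → fS S k * (X ^ k)) + sumTo n (λ k → cT τ k * (X ^ k))
  h-polynomial-identity X = begin
    sumTo (suc (suc n)) (λ k → hT τ k * X ^ k * (X + 1) ^ (suc n ∸ k))
      ≡⟨ sumTo-cong (suc (suc n)) (λ k _ → *-assoc (hT τ k) _ _) ⟩
    sumTo (suc (suc n)) (λ k → hT τ k * u k)
      ≡⟨ sumTo-count (suc (suc n)) (λ k t → order t ≡ᵇ k) u τ ⟩
    sumBy (λ t → sumTo (suc (suc n)) (λ k → 𝟙 (order t ≡ᵇ k) * u k)) τ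
      ≡⟨ sumBy-cong-∈ τ (λ t∈τ → sumTo-𝟙-≡ᵇ (suc (suc n)) _ u (s≤s (order≤ (profileOf t∈τ)))) ⟩
    sumBy (λ t → u (order t)) τ
      ≡⟨ sumBy-cong-∈ τ (λ t∈τ → faceGF-order (profileOf t∈τ) X) ⟩
    sumBy (λ t → faceGF (pts t) X + critTerms t) τ
      ≡⟨ sumBy-+ (λ t → faceGF (pts t) X) critTerms τ ⟩
    sumBy (λ t → faceGF (pts t) X) τ + sumBy critTerms τ
      ≡⟨ cong₂ _+_ (trans (faceGF-partition X) (sym (faceGF-InS {S = S} pure X)))
                   (sym (sumTo-count n (λ k t → isCritIdx t k) (X ^_) τ)) ⟩
    X * sumTo (suc n) (λ k → fS S k * X ^ k) + sumTo n (λ k → cT τ k * X ^ k) ∎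
    where
      open TileProfile
      u : ℕ → ℕ
      u k = X ^ k * (X + 1) ^ (suc n ∸ k)
      critTerms : Tile V → ℕ
      critTerms t = sumTo n (λ k → 𝟙 (isCritIdx t k) * X ^ k)

  cT-n≡hT-1+n : cT τ n ≡ hT τ (suc n)
  cT-n≡hT-1+n = count-cong-∈ τ (λ t∈τ → TileProfile.isCritIdx-top (profileOf t∈τ))

low-digit : ∀ {a b} p q → a + suc (a + b) * p ≡ b + suc (a + b) * q → a ≡ b
low-digit {a} {b} p q e = begin
  a                               ≡⟨ sym (m<n⇒m%n≡m (s≤s (m≤m+n a b))) ⟩
  a % suc (a + b)                 ≡⟨ sym ([m+kn]%n≡m%n a p (suc (a + b))) ⟩
  (a + p * suc (a + b)) % suc (a + b) ≡⟨ cong (λ z → (a + z) % suc (a + b)) (*-comm p _) ⟩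
  (a + suc (a + b) * p) % suc (a + b) ≡⟨ cong (_% suc (a + b)) e ⟩
  (b + suc (a + b) * q) % suc (a + b) ≡⟨ cong (λ z → (b + z) % suc (a + b)) (*-comm _ q) ⟩
  (b + q * suc (a + b)) % suc (a + b) ≡⟨ [m+kn]%n≡m%n b q (suc (a + b)) ⟩
  b % suc (a + b)                 ≡⟨ m<n⇒m%n≡m (s≤s (m≤n+m b a)) ⟩
  b                               ∎

-- Evaluating at X = a + b + 1 exposes the constant terms as residues.
split-constant : ∀ {a b} (p q : ℕ → ℕ) → (∀ X → 1 ≤ X → a + X * p X ≡ b + X * q X) →
  a ≡ b × (∀ X → 1 ≤ X → p X ≡ q X)
split-constant {a} {b} p q h = a≡b , p≗q
  where
    a≡b = low-digit (p (suc (a + b))) (q (suc (a + b))) (h (suc (a + b)) (s≤s z≤n))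
    p≗q : ∀ X → 1 ≤ X → p X ≡ q X
    p≗q (suc X) 1≤X = *-cancelˡ-≡ (p (suc X)) (q (suc X)) (suc X)
      (+-cancelˡ-≡ a _ _ (trans (h (suc X) 1≤X) (cong (_+ suc X * q (suc X)) (sym a≡b))))

sumTo-poly-suc : ∀ m (a : ℕ → ℕ) X → sumTo (suc m) (λ k → a k * X ^ k) ≡ a 0 + X * sumTo m (λ k → a (suc k) * X ^ k)
sumTo-poly-suc m a X = begin
  sumTo (suc m) (λ k → a k * X ^ k)                    ≡⟨ sumTo-suc m _ ⟩
  a 0 * 1 + sumTo m (λ k → a (suc k) * (X * X ^ k))
    ≡⟨ cong₂ _+_ (*-identityʳ (a 0)) (trans (sumTo-cong m (λ k _ → x∙yz≈y∙xz (a (suc k)) X _)) (sumTo-*ˡ m X _)) ⟩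
  a 0 + X * sumTo m (λ k → a (suc k) * X ^ k)          ∎

poly-coefficients-unique : ∀ m (a b : ℕ → ℕ) →
  (∀ X → 1 ≤ X → sumTo m (λ k → a k * X ^ k) ≡ sumTo m (λ k → b k * X ^ k)) → ∀ k → k < m → a k ≡ b k
poly-coefficients-unique (suc m) a b h k k<1+m with split-constant _ _ (λ X 1≤X →
    trans (sym (sumTo-poly-suc m a X)) (trans (h X 1≤X) (sumTo-poly-suc m b X)))
... | a₀≡b₀ , tails with k
...   | zero = a₀≡b₀
...   | suc k = poly-coefficients-unique m (a ∘ suc) (b ∘ suc) tails k (≤-pred k<1+m)

hPoly : ℕ → (ℕ → ℕ) → ℕ → ℕ
hPoly m a X = sumTo (suc m) (λ k → a k * X ^ k * (X + 1) ^ (m ∸ k))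

^-geometric : ∀ m X → (X + 1) ^ m ≡ 1 + X * sumTo m ((X + 1) ^_)
^-geometric zero X = cong suc (sym (*-zeroʳ X))
^-geometric (suc m) X = begin
  (X + 1) * P             ≡⟨ *-distribʳ-+ P X 1 ⟩
  X * P + 1 * P           ≡⟨ cong (X * P +_) (trans (*-identityˡ P) (^-geometric m X)) ⟩
  X * P + (1 + X * G)     ≡⟨ +-comm (X * P) _ ⟩
  1 + (X * G + X * P)     ≡⟨ cong suc (sym (*-distribˡ-+ X G P)) ⟩
  1 + X * (G + P)         ∎
  where
    P = (X + 1) ^ m
    G = sumTo m ((X + 1) ^_)

hPoly-suc : ∀ m (a : ℕ → ℕ) X →
  hPoly (suc m) a X ≡ a 0 + X * (a 0 * sumTo (suc m) ((X + 1) ^_) + hPoly m (a ∘ suc) X)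
hPoly-suc m a X = begin
  hPoly (suc m) a X                                       ≡⟨ sumTo-suc (suc m) _ ⟩
  a 0 * 1 * (X + 1) ^ suc m + sumTo (suc m) (λ k → a (suc k) * (X * X ^ k) * (X + 1) ^ (m ∸ k))
    ≡⟨ cong₂ _+_ (cong₂ _*_ (*-identityʳ (a 0)) (^-geometric (suc m) X))
                 (trans (sumTo-cong (suc m) (λ k _ → pull-X (a (suc k)) (X ^ k) _)) (sumTo-*ˡ (suc m) X _)) ⟩
  a 0 * (1 + X * G) + X * hPoly m (a ∘ suc) X             ≡⟨ cong (_+ X * hPoly m (a ∘ suc) X) (*-distribˡ-+ (a 0) 1 (X * G)) ⟩
  a 0 * 1 + a 0 * (X * G) + X * hPoly m (a ∘ suc) X
    ≡⟨ cong₂ (λ u v → u + v + X * hPoly m (a ∘ suc) X) (*-identityʳ (a 0)) (x∙yz≈y∙xz (a 0) X G) ⟩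
  a 0 + X * (a 0 * G) + X * hPoly m (a ∘ suc) X           ≡⟨ +-assoc (a 0) _ _ ⟩
  a 0 + (X * (a 0 * G) + X * hPoly m (a ∘ suc) X)         ≡⟨ cong (a 0 +_) (sym (*-distribˡ-+ X _ _)) ⟩
  a 0 + X * (a 0 * G + hPoly m (a ∘ suc) X)               ∎
  where
    G = sumTo (suc m) ((X + 1) ^_)
    pull-X : ∀ c y z → c * (X * y) * z ≡ X * (c * y * z)
    pull-X c y z = trans (cong (_* z) (x∙yz≈y∙xz c X y)) (*-assoc X (c * y) z)

hPoly-coefficients-unique : ∀ m (a b : ℕ → ℕ) → (∀ X → 1 ≤ X → hPoly m a X ≡ hPoly m b X) → ∀ k → k ≤ m → a k ≡ b k
hPoly-coefficients-unique zero a b h zero _ =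
  trans (sym (trans (*-identityʳ _) (*-identityʳ _))) (trans (h 1 (s≤s z≤n)) (trans (*-identityʳ _) (*-identityʳ _)))
hPoly-coefficients-unique (suc m) a b h k k≤1+m with split-constant _ _ (λ X 1≤X →
    trans (sym (hPoly-suc m a X)) (trans (h X 1≤X) (hPoly-suc m b X)))
... | a₀≡b₀ , tails with k
...   | zero = a₀≡b₀
...   | suc k = hPoly-coefficients-unique m (a ∘ suc) (b ∘ suc)
  (λ X 1≤X → +-cancelˡ-≡ (a 0 * sumTo (suc m) ((X + 1) ^_)) _ _
    (trans (tails X 1≤X) (cong (λ c → c * sumTo (suc m) ((X + 1) ^_) + hPoly m (b ∘ suc) X) (sym a₀≡b₀))))
  k (≤-pred k≤1+m)

tabulate-toℕ-≡⇔ : ∀ m (f g : ℕ → ℕ) → (tabulate {n = m} (f ∘ toℕ) ≡ tabulate (g ∘ toℕ)) ⇔ (∀ k → k < m → f k ≡ g k)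
tabulate-toℕ-≡⇔ m f g = mk⇔ pointwise (λ f≗g → tabulate-cong (λ i → f≗g (toℕ i) (toℕ<n i)))
  where
    pointwise : tabulate (f ∘ toℕ) ≡ tabulate (g ∘ toℕ) → ∀ k → k < m → f k ≡ g k
    pointwise e k k<m = begin
      f k                                       ≡⟨ cong f (sym (toℕ-fromℕ< k<m)) ⟩
      f (toℕ (fromℕ< k<m))                      ≡⟨ sym (lookup∘tabulate (f ∘ toℕ) (fromℕ< k<m)) ⟩
      lookup (tabulate (f ∘ toℕ)) (fromℕ< k<m) ≡⟨ cong (λ v → lookup v (fromℕ< k<m)) e ⟩
      lookup (tabulate (g ∘ toℕ)) (fromℕ< k<m) ≡⟨ lookup∘tabulate (g ∘ toℕ) (fromℕ< k<m) ⟩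
      g (toℕ (fromℕ< k<m))                      ≡⟨ cong g (toℕ-fromℕ< k<m) ⟩
      g k                                       ∎

same-h⇒same-c : ∀ {V} {n} {S : RelComplex V} (pure : Pure n S) {τ τ'} → HTiling S τ → HTiling S τ' →
  (∀ k → k < suc (suc n) → hT τ k ≡ hT τ' k) → ∀ k → k < suc n → cT τ k ≡ cT τ' k
same-h⇒same-c {n = n} {S} pure {τ} {τ'} H H' h≗h' k k<1+n with m≤n⇒m<n∨m≡n (≤-pred k<1+n)
... | inj₂ refl = trans (cT-n≡hT-1+n pure H) (trans (h≗h' (suc n) ≤-refl) (sym (cT-n≡hT-1+n pure H')))
... | inj₁ k<n = poly-coefficients-unique n (cT τ) (cT τ') cPoly≡ k k<n
  where
    cPoly≡ : ∀ X → 1 ≤ X → sumTo n (λ k → cT τ k * X ^ k) ≡ sumTo n (λ k → cT τ' k * X ^ k)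
    cPoly≡ X _ = +-cancelˡ-≡ (X * sumTo (suc n) (λ k → fS S k * X ^ k)) _ _ (begin
      X * sumTo (suc n) (λ k → fS S k * X ^ k) + sumTo n (λ k → cT τ k * X ^ k)  ≡⟨ sym (h-polynomial-identity pure H X) ⟩
      hPoly (suc n) (hT τ) X
        ≡⟨ sumTo-cong (suc (suc n)) (λ k k<2+n → cong (λ h → h * X ^ k * (X + 1) ^ (suc n ∸ k)) (h≗h' k k<2+n)) ⟩
      hPoly (suc n) (hT τ') X                                                      ≡⟨ h-polynomial-identity pure H' X ⟩
      X * sumTo (suc n) (λ k → fS S k * X ^ k) + sumTo n (λ k → cT τ' k * X ^ k) ∎)

same-c⇒same-h : ∀ {V} {n} {S : RelComplex V} (pure : Pure n S) {τ τ'} → HTiling S τ → HTiling S τ' →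
  (∀ k → k < suc n → cT τ k ≡ cT τ' k) → ∀ k → k < suc (suc n) → hT τ k ≡ hT τ' k
same-c⇒same-h {n = n} {S} pure {τ} {τ'} H H' c≗c' k k<2+n =
  hPoly-coefficients-unique (suc n) (hT τ) (hT τ') hPoly≡ k (≤-pred k<2+n)
  where
    hPoly≡ : ∀ X → 1 ≤ X → hPoly (suc n) (hT τ) X ≡ hPoly (suc n) (hT τ') X
    hPoly≡ X _ = begin
      hPoly (suc n) (hT τ) X                                                       ≡⟨ h-polynomial-identity pure H X ⟩
      X * sumTo (suc n) (λ k → fS S k * X ^ k) + sumTo n (λ k → cT τ k * X ^ k)
        ≡⟨ cong (X * sumTo (suc n) (λ k → fS S k * X ^ k) +_)
                (sumTo-cong n (λ k k<n → cong (_* X ^ k) (c≗c' k (m<n⇒m<1+n k<n)))) ⟩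
      X * sumTo (suc n) (λ k → fS S k * X ^ k) + sumTo n (λ k → cT τ' k * X ^ k)  ≡⟨ sym (h-polynomial-identity pure H' X) ⟩
      hPoly (suc n) (hT τ') X                                                      ∎

theorem1p6 : ∀ {V : ℕ} (n : ℕ) (S : RelComplex V) → Pure n S →
    (τ : List (Tile V)) → HTiling S τ →
    (∀ (X : ℕ) →
      sumTo (suc (suc n)) (λ k → hT τ k * (X ^ k) * ((X + 1) ^ (suc n ∸ k)))
      ≡ X * sumTo (suc n) (λ k → fS S k * (X ^ k)) + sumTo n (λ k → cT τ k * (X ^ k)))
    × (∀ (τ' : List (Tile V)) → HTiling S τ' → (hVec n τ ≡ hVec n τ' ⇔ cVec n τ ≡ cVec n τ'))
theorem1p6 n S pure τ H = h-polynomial-identity pure H , λ τ' H' → mk⇔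
  (λ same-h → from (c-vectors τ') (same-h⇒same-c pure H H' (to (h-vectors τ') same-h)))
  (λ same-c → from (h-vectors τ') (same-c⇒same-h pure H H' (to (c-vectors τ') same-c)))
  where
    open Equivalence
    h-vectors : ∀ τ' → (hVec n τ ≡ hVec n τ') ⇔ (∀ k → k < suc (suc n) → hT τ k ≡ hT τ' k)
    h-vectors τ' = tabulate-toℕ-≡⇔ (suc (suc n)) (hT τ) (hT τ')
    c-vectors : ∀ τ' → (cVec n τ ≡ cVec n τ') ⇔ (∀ k → k < suc n → cT τ k ≡ cT τ' k)
    c-vectors τ' = tabulate-toℕ-≡⇔ (suc n) (cT τ) (cT τ')
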